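{- Let $k$ be a positive integer and let $A,B$ be disjoint vertex sets in a tournament. If $d(A,B)\ge\beta$ for some $0<\beta\le 1/2$, and $|A|,|B|\ge \beta^{ -5k}$, then there are sets $X\subseteq A$ and $Y\subseteq B$, each inducing a transitive tournament on $k$ vertices, such that $X\Rightarrow Y$.
   Context: A tournament is a complete graph with every edge oriented. It is transitive if its vertices can be ordered so that every edge is oriented from the earlier to the later vertex. For vertex sets $A,B$, $e(A,B)$ is the number of edges oriented from $A$ to $B$ and $d(A,B)=e(A,B)/(|A||B|)$. We write $A\Rightarrow B$ if $A$ and $B$ are disjoint and every vertex of $A$ has an edge oriented to every vertex of $B$.
   Formalization: The parameter β ranges over the rationals, with 0<β and β at most 1/2. -}

module Defs where

open import Data.Nat using (ℕ; zero; suc)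
open import Data.Bool using (Bool; true; false)
open import Data.Fin using (Fin; _<_)
open import Data.Fin.Subset using (Subset; _∈_; _∉_; _⊆_; ∣_∣)
open import Data.List using (List; filter; length; allFin; cartesianProduct)
open import Data.Product using (Σ; ∃; _×_; _,_; proj₁; proj₂)
open import Data.Rational using (ℚ; 1ℚ; _*_)
import Data.Integer
import Data.Rational
open import Function.Definitions using (Injective)
open import Relation.Binary.PropositionalEquality using (_≡_; _≢_)
open import Relation.Nullary using (¬_; Dec)
open import Relation.Nullary.Decidable using (_×-dec_)
open import Data.Bool using (_≟_)
open import Data.Fin.Subset.Properties using (_∈?_)

-- A tournament on the vertex set Fin n: adj u v ≡ true means the edge
-- between u and v is oriented from u to v.
record Tournament (n : ℕ) : Set where
  field
    adj     : Fin n → Fin n → Bool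
    irrefl  : ∀ v → adj v v ≡ false
    oriented : ∀ u v → u ≢ v → adj u v ≢ adj v u
open Tournament public

Disjoint : ∀ {n} → Subset n → Subset n → Set
Disjoint A B = ∀ v → v ∈ A → v ∉ B

e : ∀ {n} → Tournament n → Subset n → Subset n → ℕ
e T A B = length (filter (λ p → ((proj₁ p ∈? A) ×-dec (proj₂ p ∈? B)) ×-dec (adj T (proj₁ p) (proj₂ p) ≟ true))
                         (cartesianProduct (allFin _) (allFin _)))

_⇒_ : ∀ {n} → Tournament n → Subset n → Subset n → Set
_⇒_ T A B = Disjoint A B × (∀ a b → a ∈ A → b ∈ B → adj T a b ≡ true)

Transitive : ∀ {n} → Tournament n → Subset n → Set
Transitive {n} T X =
  Σ (Fin ∣ X ∣ → Fin n) λ σ →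
    Injective _≡_ _≡_ σ
    × (∀ i → σ i ∈ X)
    × (∀ v → v ∈ X → ∃ λ i → σ i ≡ v)
    × (∀ i j → i < j → adj T (σ i) (σ j) ≡ true)

_^ℚ_ : ℚ → ℕ → ℚ
p ^ℚ zero = 1ℚ
p ^ℚ suc m = p * (p ^ℚ m)

ℕtoℚ : ℕ → ℚ
ℕtoℚ m = Data.Integer.+ m Data.Rational./ 1

module Submission where

-- Write β = p/q and m = min(|A|,|B|).  Deleting vertices of A of below-average out-degree into B
-- gives A' ⊆ A with |A'| = m and the same density.  Count, over all t-tuples τ of vertices (t = 2k),
-- the vertices of A' dominating τ ⊆ B: by the power-mean inequality there are at least
-- p^t m |B|^t / q^t such pairs, while the k-tuples of A' with fewer than K = 2^(k-1) common
-- out-neighbours in B are dominated by at most m^k K^t such τ.  Since |A|, |B| ≥ (q/p)^(5k) the first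
-- count wins, so for some τ the set U of its dominators has |U| ≥ K and every k-tuple in U has at
-- least K common out-neighbours.  A tournament on 2^(k-1) vertices contains a transitive
-- subtournament on k vertices (Erdős–Moser); apply this in U and then in the common
-- out-neighbourhood of the set X found there.

module _ where

  open import Data.Bool as Bool using (Bool; true; false; _∧_; not; T)
  open import Data.Bool.Properties using (∧-assoc)
  open import Data.Empty using (⊥-elim)
  open import Data.Unit using (tt)
  open import Data.Fin as Fin using (Fin; zero; suc; toℕ; cast)
  open import Data.Fin.Properties using (toℕ-injective; toℕ-cast; cast-involutive)
  open import Data.Fin.Subset using (Subset; _∈_; _⊆_; _∩_; ∣_∣; Nonempty)
  open import Data.Fin.Subset.Properties using (_∈?_; p∩q⊆p; x∈p∩q⁺; x∈p∩q⁻; nonempty?; Empty-unique; ∣⊥∣≡0)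
  open import Data.List as List using (List; []; _∷_; _++_; length; filter; cartesianProduct; allFin)
  open import Data.List.Properties using (map-++; map-∘)
  open import Data.Nat.ListAction using () renaming (sum to sumₗ)
  open import Data.Nat.ListAction.Properties using (sum-++)
  open import Data.Nat
  open import Data.Nat.Properties
  open import Data.Nat.Tactic.RingSolver using (solve-∀)
  open import Data.Sum using (inj₁; inj₂)
  open import Data.Product using (∃; ∃₂; _×_; _,_; proj₁; proj₂)
  open import Data.Vec using (Vec; []; _∷_; _∷ʳ_; lookup; tabulate)
  open import Data.Vec.Relation.Unary.All as All using (All; []; _∷_)
  open import Data.Vec.Relation.Unary.All.Properties using (lookup⁺; lookup⁻)
  open import Data.Vec.Relation.Unary.AllPairs using (AllPairs; []; _∷_)
  open import Data.Vec.Properties using (lookup∘tabulate; lookup-zipWith; []=⇒lookup; lookup⇒[]=)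
  open import Relation.Binary.PropositionalEquality
  open import Relation.Nullary using (yes; no; does; contradiction)
  open import Relation.Nullary.Decidable using (_×-dec_; dec-true; dec-false)
  open import Relation.Unary using (Decidable)
  open import Function using (id; _∘_)
  open import Function.Definitions using (Injective)
  open import Relation.Binary using (tri<; tri≈; tri>)
  open import Data.Vec.Relation.Unary.Any using (index)
  open import Data.Vec.Relation.Unary.Any.Properties using (lookup-index)
  open import Data.Vec.Membership.Propositional.Properties using (∈-lookup)
  open import Algebra.Properties.Semiring.Sum +-*-semiring
    using (sum-syntax; ∑-comm; ∑-distrib-+; *-distribˡ-sum; *-distribʳ-sum; sum-cong-≗; sum-replicate-zero)
  import Data.Integer as ℤ
  import Data.Integer.Properties as ℤ
  open import Data.Nat.Coprimality using (Coprime)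
  open import Data.Rational as ℚ using (mkℚ; ½; 1/_; toℚᵘ)
  open import Data.Rational.Properties using (toℚᵘ-mono-≤; toℚᵘ-homo-*; toℚᵘ-fromℚᵘ)
  open import Data.Rational.Unnormalised as ℚᵘ using (ℚᵘ; mkℚᵘ) renaming (↥_ to ↥ᵘ_; ↧_ to ↧ᵘ_)
  import Data.Rational.Unnormalised.Properties as ℚᵘ
  open import Defs

  𝟙 : Bool → ℕ
  𝟙 true  = 1
  𝟙 false = 0

  𝟙≤1 : ∀ b → 𝟙 b ≤ 1
  𝟙≤1 true  = ≤-refl
  𝟙≤1 false = z≤n

  𝟙-∧ : ∀ a b → 𝟙 (a ∧ b) ≡ 𝟙 a * 𝟙 b
  𝟙-∧ true  b = sym (+-identityʳ (𝟙 b))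
  𝟙-∧ false b = refl

  𝟙≡1⇒≡true : ∀ {b} → 𝟙 b ≡ 1 → b ≡ true
  𝟙≡1⇒≡true {true} _ = refl

  ∑-mono-≤ : ∀ {n} {f g : Fin n → ℕ} → (∀ i → f i ≤ g i) → ∑[ i < n ] f i ≤ ∑[ i < n ] g i
  ∑-mono-≤ {zero}  f≤g = z≤n
  ∑-mono-≤ {suc n} f≤g = +-mono-≤ (f≤g zero) (∑-mono-≤ (λ i → f≤g (suc i)))

  term≤∑ : ∀ {n} (f : Fin n → ℕ) i → f i ≤ ∑[ j < n ] f j
  term≤∑ f zero    = m≤m+n (f zero) _
  term≤∑ f (suc i) = m≤n⇒m≤o+n (f zero) (term≤∑ (λ j → f (suc j)) i)

  ∑-<⇒∃< : ∀ {n} (f g : Fin n → ℕ) → ∑[ i < n ] f i < ∑[ i < n ] g i → ∃ λ i → f i < g i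
  ∑-<⇒∃< {zero}  f g ()
  ∑-<⇒∃< {suc n} f g ∑f<∑g with f zero <? g zero
  ... | yes f₀<g₀ = zero , f₀<g₀
  ... | no  f₀≮g₀ with ∑-<⇒∃< (λ i → f (suc i)) (λ i → g (suc i))
                          (+-cancelˡ-< (f zero) _ _ (<-≤-trans ∑f<∑g (+-monoˡ-≤ _ (≮⇒≥ f₀≮g₀))))
  ... | i , fᵢ<gᵢ = suc i , fᵢ<gᵢ

  δ : ∀ {n} → Fin n → Fin n → ℕ
  δ v w = 𝟙 (does (w Fin.≟ v))

  ∑-δ* : ∀ {n} (v : Fin n) (f : Fin n → ℕ) → ∑[ w < n ] (δ v w * f w) ≡ f v
  ∑-δ* {suc n} zero    f = trans (cong₂ _+_ (+-identityʳ (f zero)) (sum-replicate-zero n)) (+-identityʳ (f zero))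
  ∑-δ* {suc n} (suc v) f = ∑-δ* v (λ w → f (suc w))

  ∑-δ : ∀ {n} (v : Fin n) → ∑[ w < n ] δ v w ≡ 1
  ∑-δ v = trans (sum-cong-≗ (λ w → sym (*-identityʳ (δ v w)))) (∑-δ* v (λ _ → 1))

  χ : ∀ {n} → Subset n → Fin n → ℕ
  χ S v = 𝟙 (lookup S v)

  χ≤1 : ∀ {n} (S : Subset n) v → χ S v ≤ 1
  χ≤1 S v = 𝟙≤1 (lookup S v)

  ∈⇒χ≡1 : ∀ {n} {S : Subset n} {v} → v ∈ S → χ S v ≡ 1
  ∈⇒χ≡1 v∈S = cong 𝟙 ([]=⇒lookup v∈S)

  ∣S∣≡∑χ : ∀ {n} (S : Subset n) → ∣ S ∣ ≡ ∑[ v < n ] χ S v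
  ∣S∣≡∑χ []          = refl
  ∣S∣≡∑χ (true  ∷ S) = cong suc (∣S∣≡∑χ S)
  ∣S∣≡∑χ (false ∷ S) = ∣S∣≡∑χ S

  ∣S∣>0⇒Nonempty : ∀ {n} (S : Subset n) → 0 < ∣ S ∣ → Nonempty S
  ∣S∣>0⇒Nonempty {n} S ∣S∣>0 with nonempty? S
  ... | yes S≢∅ = S≢∅
  ... | no  S≡∅ = contradiction (trans (cong ∣_∣ (Empty-unique S≡∅)) (∣⊥∣≡0 n)) (>⇒≢ ∣S∣>0)

  ⟦_⟧ : ∀ {n} → (Fin n → Bool) → Subset n
  ⟦ p ⟧ = tabulate p

  ∈⟦⟧⁺ : ∀ {n} {p : Fin n → Bool} {v} → p v ≡ true → v ∈ ⟦ p ⟧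
  ∈⟦⟧⁺ {p = p} {v} pv = lookup⇒[]= v (tabulate p) (trans (lookup∘tabulate p v) pv)

  ∈⟦⟧⁻ : ∀ {n} {p : Fin n → Bool} {v} → v ∈ ⟦ p ⟧ → p v ≡ true
  ∈⟦⟧⁻ {p = p} {v} v∈p = trans (sym (lookup∘tabulate p v)) ([]=⇒lookup v∈p)

  χ-∩⟦⟧ : ∀ {n} (S : Subset n) (p : Fin n → Bool) v → χ (S ∩ ⟦ p ⟧) v ≡ χ S v * 𝟙 (p v)
  χ-∩⟦⟧ S p v = begin
    𝟙 (lookup (S ∩ ⟦ p ⟧) v)              ≡⟨ cong 𝟙 (lookup-zipWith _∧_ v S (tabulate p)) ⟩
    𝟙 (lookup S v ∧ lookup (tabulate p) v) ≡⟨ cong (λ b → 𝟙 (lookup S v ∧ b)) (lookup∘tabulate p v) ⟩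
    𝟙 (lookup S v ∧ p v)                   ≡⟨ 𝟙-∧ (lookup S v) (p v) ⟩
    χ S v * 𝟙 (p v)                        ∎
    where open ≡-Reasoning

  ∣∩⟦⟧∣ : ∀ {n} (S : Subset n) (p : Fin n → Bool) → ∣ S ∩ ⟦ p ⟧ ∣ ≡ ∑[ v < n ] (χ S v * 𝟙 (p v))
  ∣∩⟦⟧∣ S p = trans (∣S∣≡∑χ (S ∩ ⟦ p ⟧)) (sum-cong-≗ (χ-∩⟦⟧ S p))

  module _ {n : ℕ} where

    ∑ᵥ : (m : ℕ) → (Vec (Fin n) m → ℕ) → ℕ
    ∑ᵥ zero    F = F []
    ∑ᵥ (suc m) F = ∑[ v < n ] ∑ᵥ m (λ τ → F (v ∷ τ))

    ∏ᵥ : ∀ {m} → Vec (Fin n) m → (Fin n → ℕ) → ℕ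
    ∏ᵥ []      f = 1
    ∏ᵥ (v ∷ τ) f = f v * ∏ᵥ τ f

    allᵇ : ∀ {m} → (Fin n → Bool) → Vec (Fin n) m → Bool
    allᵇ p []      = true
    allᵇ p (v ∷ τ) = p v ∧ allᵇ p τ

    ∑ᵥ-cong : ∀ m {F G : Vec (Fin n) m → ℕ} → (∀ τ → F τ ≡ G τ) → ∑ᵥ m F ≡ ∑ᵥ m G
    ∑ᵥ-cong zero    F≗G = F≗G []
    ∑ᵥ-cong (suc m) F≗G = sum-cong-≗ (λ v → ∑ᵥ-cong m (λ τ → F≗G (v ∷ τ)))

    ∑ᵥ-mono-≤ : ∀ m {F G : Vec (Fin n) m → ℕ} → (∀ τ → F τ ≤ G τ) → ∑ᵥ m F ≤ ∑ᵥ m G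
    ∑ᵥ-mono-≤ zero    F≤G = F≤G []
    ∑ᵥ-mono-≤ (suc m) F≤G = ∑-mono-≤ (λ v → ∑ᵥ-mono-≤ m (λ τ → F≤G (v ∷ τ)))

    ∑ᵥ-distrib-+ : ∀ m (F G : Vec (Fin n) m → ℕ) → ∑ᵥ m (λ τ → F τ + G τ) ≡ ∑ᵥ m F + ∑ᵥ m G
    ∑ᵥ-distrib-+ zero    F G = refl
    ∑ᵥ-distrib-+ (suc m) F G =
      trans (sum-cong-≗ (λ v → ∑ᵥ-distrib-+ m (λ τ → F (v ∷ τ)) (λ τ → G (v ∷ τ))))
            (∑-distrib-+ (λ v → ∑ᵥ m (λ τ → F (v ∷ τ))) (λ v → ∑ᵥ m (λ τ → G (v ∷ τ))))

    *-distribˡ-∑ᵥ : ∀ m c (F : Vec (Fin n) m → ℕ) → c * ∑ᵥ m F ≡ ∑ᵥ m (λ τ → c * F τ)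
    *-distribˡ-∑ᵥ zero    c F = refl
    *-distribˡ-∑ᵥ (suc m) c F =
      trans (*-distribˡ-sum c (λ v → ∑ᵥ m (λ τ → F (v ∷ τ))))
            (sum-cong-≗ (λ v → *-distribˡ-∑ᵥ m c (λ τ → F (v ∷ τ))))

    *-distribʳ-∑ᵥ : ∀ m c (F : Vec (Fin n) m → ℕ) → ∑ᵥ m F * c ≡ ∑ᵥ m (λ τ → F τ * c)
    *-distribʳ-∑ᵥ m c F = trans (*-comm (∑ᵥ m F) c)
      (trans (*-distribˡ-∑ᵥ m c F) (∑ᵥ-cong m (λ τ → *-comm c (F τ))))

    ∑ᵥ-∑-comm : ∀ m {k} (F : Fin k → Vec (Fin n) m → ℕ) →
                ∑ᵥ m (λ τ → ∑[ a < k ] F a τ) ≡ ∑[ a < k ] ∑ᵥ m (F a)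
    ∑ᵥ-∑-comm zero    F = refl
    ∑ᵥ-∑-comm (suc m) F =
      trans (sum-cong-≗ (λ v → ∑ᵥ-∑-comm m (λ a τ → F a (v ∷ τ))))
            (∑-comm (λ v a → ∑ᵥ m (λ τ → F a (v ∷ τ))))

    ∑ᵥ-comm : ∀ m l (F : Vec (Fin n) m → Vec (Fin n) l → ℕ) →
              ∑ᵥ m (λ τ → ∑ᵥ l (F τ)) ≡ ∑ᵥ l (λ σ → ∑ᵥ m (λ τ → F τ σ))
    ∑ᵥ-comm zero    l F = refl
    ∑ᵥ-comm (suc m) l F =
      trans (sum-cong-≗ (λ v → ∑ᵥ-comm m l (λ τ → F (v ∷ τ))))
            (sym (∑ᵥ-∑-comm l (λ v σ → ∑ᵥ m (λ τ → F (v ∷ τ) σ))))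

    term≤∑ᵥ : ∀ m (F : Vec (Fin n) m → ℕ) τ → F τ ≤ ∑ᵥ m F
    term≤∑ᵥ zero    F []      = ≤-refl
    term≤∑ᵥ (suc m) F (v ∷ τ) =
      ≤-trans (term≤∑ᵥ m (λ σ → F (v ∷ σ)) τ) (term≤∑ (λ w → ∑ᵥ m (λ σ → F (w ∷ σ))) v)

    ∑ᵥ-<⇒∃< : ∀ m (F G : Vec (Fin n) m → ℕ) → ∑ᵥ m F < ∑ᵥ m G → ∃ λ τ → F τ < G τ
    ∑ᵥ-<⇒∃< zero    F G F<G = [] , F<G
    ∑ᵥ-<⇒∃< (suc m) F G ∑F<∑G with ∑-<⇒∃< (λ v → ∑ᵥ m (λ τ → F (v ∷ τ))) (λ v → ∑ᵥ m (λ τ → G (v ∷ τ))) ∑F<∑G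
    ... | v , ∑Fᵥ<∑Gᵥ with ∑ᵥ-<⇒∃< m (λ τ → F (v ∷ τ)) (λ τ → G (v ∷ τ)) ∑Fᵥ<∑Gᵥ
    ... | τ , Fτ<Gτ = v ∷ τ , Fτ<Gτ

    ∑ᵥ-∏ᵥ : ∀ m (f : Fin n → ℕ) → ∑ᵥ m (λ τ → ∏ᵥ τ f) ≡ (∑[ v < n ] f v) ^ m
    ∑ᵥ-∏ᵥ zero    f = refl
    ∑ᵥ-∏ᵥ (suc m) f = begin
      ∑[ v < n ] ∑ᵥ m (λ τ → f v * ∏ᵥ τ f)  ≡⟨ sum-cong-≗ (λ v → sym (*-distribˡ-∑ᵥ m (f v) (λ τ → ∏ᵥ τ f))) ⟩
      ∑[ v < n ] (f v * ∑ᵥ m (λ τ → ∏ᵥ τ f)) ≡⟨ sum-cong-≗ (λ v → cong (f v *_) (∑ᵥ-∏ᵥ m f)) ⟩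
      ∑[ v < n ] (f v * S ^ m)               ≡⟨ *-distribʳ-sum (S ^ m) f ⟨
      S * S ^ m                              ∎
      where
      open ≡-Reasoning
      S = ∑[ v < n ] f v

    ∏ᵥ-mono-≤ : ∀ {m} (τ : Vec (Fin n) m) {f g : Fin n → ℕ} → (∀ v → f v ≤ g v) → ∏ᵥ τ f ≤ ∏ᵥ τ g
    ∏ᵥ-mono-≤ []      f≤g = ≤-refl
    ∏ᵥ-mono-≤ (v ∷ τ) f≤g = *-mono-≤ (f≤g v) (∏ᵥ-mono-≤ τ f≤g)

    𝟙-allᵇ : ∀ {m} (p : Fin n → Bool) (τ : Vec (Fin n) m) → 𝟙 (allᵇ p τ) ≡ ∏ᵥ τ (λ v → 𝟙 (p v))
    𝟙-allᵇ p []      = refl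
    𝟙-allᵇ p (v ∷ τ) = trans (𝟙-∧ (p v) (allᵇ p τ)) (cong (𝟙 (p v) *_) (𝟙-allᵇ p τ))

    allᵇ⁺ : ∀ {m} {p : Fin n → Bool} {τ : Vec (Fin n) m} → All (λ v → p v ≡ true) τ → allᵇ p τ ≡ true
    allᵇ⁺ []            = refl
    allᵇ⁺ (pv ∷ pτ) rewrite pv = allᵇ⁺ pτ

    allᵇ⁻ : ∀ {m} {p : Fin n → Bool} (τ : Vec (Fin n) m) → allᵇ p τ ≡ true → All (λ v → p v ≡ true) τ
    allᵇ⁻ []               _     = []
    allᵇ⁻ {p = p} (v ∷ τ) allpτ with p v in pv
    ... | true = pv ∷ allᵇ⁻ τ allpτ

  module _ {n : ℕ} where

    _⊆ᵇ_ : ∀ {m} → Vec (Fin n) m → Subset n → Bool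
    τ ⊆ᵇ S = allᵇ (lookup S) τ

    ⊆ᵇ⁺ : ∀ {m} {τ : Vec (Fin n) m} {S} → All (_∈ S) τ → τ ⊆ᵇ S ≡ true
    ⊆ᵇ⁺ τ⊆S = allᵇ⁺ (All.map []=⇒lookup τ⊆S)

    ⊆ᵇ⁻ : ∀ {m} {τ : Vec (Fin n) m} {S} → τ ⊆ᵇ S ≡ true → All (_∈ S) τ
    ⊆ᵇ⁻ {τ = τ} {S} τ⊆ᵇS = All.map (lookup⇒[]= _ S) (allᵇ⁻ τ τ⊆ᵇS)

    𝟙-⊆ᵇ : ∀ {m} (τ : Vec (Fin n) m) S → 𝟙 (τ ⊆ᵇ S) ≡ ∏ᵥ τ (χ S)
    𝟙-⊆ᵇ τ S = 𝟙-allᵇ (lookup S) τ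

    𝟙-⊆ᵇ-mono : ∀ {m} (τ : Vec (Fin n) m) {S S'} → S ⊆ S' → 𝟙 (τ ⊆ᵇ S) ≤ 𝟙 (τ ⊆ᵇ S')
    𝟙-⊆ᵇ-mono τ {S} {S'} S⊆S' = begin
      𝟙 (τ ⊆ᵇ S)   ≡⟨ 𝟙-⊆ᵇ τ S ⟩
      ∏ᵥ τ (χ S)   ≤⟨ ∏ᵥ-mono-≤ τ χS≤χS' ⟩
      ∏ᵥ τ (χ S')  ≡⟨ 𝟙-⊆ᵇ τ S' ⟨
      𝟙 (τ ⊆ᵇ S')  ∎
      where
      open ≤-Reasoning
      χS≤χS' : ∀ v → χ S v ≤ χ S' v
      χS≤χS' v with lookup S v in v∈S
      ... | false = z≤n
      ... | true  = ≤-reflexive (sym (∈⇒χ≡1 (S⊆S' (lookup⇒[]= v S v∈S))))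

    ∑ᵥ-⊆ᵇ : ∀ m S → ∑ᵥ m (λ τ → 𝟙 (τ ⊆ᵇ S)) ≡ ∣ S ∣ ^ m
    ∑ᵥ-⊆ᵇ m S = begin
      ∑ᵥ m (λ τ → 𝟙 (τ ⊆ᵇ S))   ≡⟨ ∑ᵥ-cong m (λ τ → 𝟙-⊆ᵇ τ S) ⟩
      ∑ᵥ m (λ τ → ∏ᵥ τ (χ S))   ≡⟨ ∑ᵥ-∏ᵥ m (χ S) ⟩
      (∑[ v < n ] χ S v) ^ m    ≡⟨ cong (_^ m) (∣S∣≡∑χ S) ⟨
      ∣ S ∣ ^ m                 ∎
      where open ≡-Reasoning

  length-filter≡sum-𝟙 : ∀ {A : Set} {P : A → Set} (P? : Decidable P) (xs : List A) →
                        length (filter P? xs) ≡ sumₗ (List.map (λ x → 𝟙 (does (P? x))) xs)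
  length-filter≡sum-𝟙 P? []       = refl
  length-filter≡sum-𝟙 P? (x ∷ xs) with does (P? x)
  ... | true  = cong suc (length-filter≡sum-𝟙 P? xs)
  ... | false = length-filter≡sum-𝟙 P? xs

  sum-map-cartesianProduct : ∀ {A B : Set} (f : A × B → ℕ) (xs : List A) (ys : List B) →
    sumₗ (List.map f (cartesianProduct xs ys)) ≡ sumₗ (List.map (λ x → sumₗ (List.map (λ y → f (x , y)) ys)) xs)
  sum-map-cartesianProduct f []       ys = refl
  sum-map-cartesianProduct f (x ∷ xs) ys = begin
    sumₗ (List.map f (List.map (x ,_) ys ++ cartesianProduct xs ys))
      ≡⟨ cong sumₗ (map-++ f (List.map (x ,_) ys) _) ⟩
    sumₗ (List.map f (List.map (x ,_) ys) ++ List.map f (cartesianProduct xs ys))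
      ≡⟨ sum-++ (List.map f (List.map (x ,_) ys)) _ ⟩
    sumₗ (List.map f (List.map (x ,_) ys)) + sumₗ (List.map f (cartesianProduct xs ys))
      ≡⟨ cong₂ _+_ (cong sumₗ (sym (map-∘ ys))) (sum-map-cartesianProduct f xs ys) ⟩
    sumₗ (List.map (λ y → f (x , y)) ys) + sumₗ (List.map (λ x → sumₗ (List.map (λ y → f (x , y)) ys)) xs) ∎
    where open ≡-Reasoning

  sum-map-tabulate : ∀ {A : Set} {n} (f : A → ℕ) (g : Fin n → A) →
                     sumₗ (List.map f (List.tabulate g)) ≡ ∑[ i < n ] f (g i)
  sum-map-tabulate {n = zero}  f g = refl
  sum-map-tabulate {n = suc n} f g = cong (f (g zero) +_) (sum-map-tabulate f (λ i → g (suc i)))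

  does-∈? : ∀ {n} (v : Fin n) (S : Subset n) → does (v ∈? S) ≡ lookup S v
  does-∈? zero    (true  ∷ S) = refl
  does-∈? zero    (false ∷ S) = refl
  does-∈? (suc v) (_ ∷ S)     = does-∈? v S

  does-≟true : ∀ b → does (b Bool.≟ true) ≡ b
  does-≟true true  = refl
  does-≟true false = refl

  outNeighbours : ∀ {n} → (Fin n → Fin n → Bool) → Subset n → Fin n → Subset n
  outNeighbours R B a = B ∩ ⟦ R a ⟧

  e≡∑∣outNeighbours∣ : ∀ {n} (T : Tournament n) (A B : Subset n) →
                 e T A B ≡ ∑[ a < n ] (χ A a * ∣ outNeighbours (adj T) B a ∣)
  e≡∑∣outNeighbours∣ {n} T A B = begin
    e T A B
      ≡⟨ length-filter≡sum-𝟙 P? (cartesianProduct (allFin n) (allFin n)) ⟩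
    sumₗ (List.map (λ p → 𝟙 (does (P? p))) (cartesianProduct (allFin n) (allFin n)))
      ≡⟨ sum-map-cartesianProduct (λ p → 𝟙 (does (P? p))) (allFin n) (allFin n) ⟩
    sumₗ (List.map (λ a → sumₗ (List.map (λ b → 𝟙 (does (P? (a , b)))) (allFin n))) (allFin n))
      ≡⟨ sum-map-tabulate {n = n} _ id ⟩
    ∑[ a < n ] sumₗ (List.map (λ b → 𝟙 (does (P? (a , b)))) (allFin n))
      ≡⟨ sum-cong-≗ (λ a → trans (sum-map-tabulate {n = n} _ id) (sum-cong-≗ (𝟙-P? a))) ⟩
    ∑[ a < n ] ∑[ b < n ] (χ A a * (χ B b * 𝟙 (adj T a b)))
      ≡⟨ sum-cong-≗ (λ a → *-distribˡ-sum (χ A a) (λ b → χ B b * 𝟙 (adj T a b))) ⟨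
    ∑[ a < n ] (χ A a * ∑[ b < n ] (χ B b * 𝟙 (adj T a b)))
      ≡⟨ sum-cong-≗ (λ a → cong (χ A a *_) (∣∩⟦⟧∣ B (adj T a))) ⟨
    ∑[ a < n ] (χ A a * ∣ outNeighbours (adj T) B a ∣) ∎
    where
    open ≡-Reasoning
    P? = λ (p : Fin n × Fin n) → ((proj₁ p ∈? A) ×-dec (proj₂ p ∈? B)) ×-dec (adj T (proj₁ p) (proj₂ p) Bool.≟ true)
    𝟙-P? : ∀ a b → 𝟙 (does (P? (a , b))) ≡ χ A a * (χ B b * 𝟙 (adj T a b))
    𝟙-P? a b rewrite does-∈? a A | does-∈? b B | does-≟true (adj T a b) = begin
      𝟙 ((lookup A a ∧ lookup B b) ∧ adj T a b) ≡⟨ cong 𝟙 (∧-assoc (lookup A a) (lookup B b) (adj T a b)) ⟩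
      𝟙 (lookup A a ∧ (lookup B b ∧ adj T a b)) ≡⟨ 𝟙-∧ (lookup A a) _ ⟩
      χ A a * 𝟙 (lookup B b ∧ adj T a b)      ≡⟨ cong (χ A a *_) (𝟙-∧ (lookup B b) (adj T a b)) ⟩
      χ A a * (χ B b * 𝟙 (adj T a b))          ∎

  -- Transitive subtournaments

  All-∷ʳ : ∀ {A : Set} {P : A → Set} {m} {xs : Vec A m} {x} → All P xs → P x → All P (xs ∷ʳ x)
  All-∷ʳ []         px = px ∷ []
  All-∷ʳ (py ∷ pxs) px = py ∷ All-∷ʳ pxs px

  AllPairs-∷ʳ : ∀ {A : Set} {R : A → A → Set} {m} {xs : Vec A m} {x} →
                AllPairs R xs → All (λ y → R y x) xs → AllPairs R (xs ∷ʳ x)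
  AllPairs-∷ʳ []           []           = [] ∷ []
  AllPairs-∷ʳ (Ry ∷ Rxs) (Ryx ∷ Rxsx) = All-∷ʳ Ry Ryx ∷ AllPairs-∷ʳ Rxs Rxsx

  AllPairs-lookup : ∀ {A : Set} {R : A → A → Set} {m} {xs : Vec A m} → AllPairs R xs →
                    ∀ i j → toℕ i < toℕ j → R (lookup xs i) (lookup xs j)
  AllPairs-lookup (Rx ∷ Rxs) zero    (suc j) _         = lookup⁺ Rx j
  AllPairs-lookup (Rx ∷ Rxs) (suc i) (suc j) (s≤s i<j) = AllPairs-lookup Rxs i j i<j

  module _ {n : ℕ} (T : Tournament n) where

    Chain : ∀ {m} → Vec (Fin n) m → Set
    Chain = AllPairs (λ u v → adj T u v ≡ true)

    Out In : Subset n → Fin n → Subset n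
    Out S v = S ∩ ⟦ adj T v ⟧
    In  S v = S ∩ ⟦ (λ w → adj T w v) ⟧

    χ≤δ+χOut+χIn : ∀ S v w → χ S w ≤ δ v w + (χ (Out S v) w + χ (In S v) w)
    χ≤δ+χOut+χIn S v w rewrite χ-∩⟦⟧ S (adj T v) w | χ-∩⟦⟧ S (λ u → adj T u v) w with w Fin.≟ v
    ... | yes _   = ≤-trans (χ≤1 S w) (m≤m+n 1 _)
    ... | no  w≢v with lookup S w | adj T v w in vw | adj T w v in wv
    ... | false | _     | _     = z≤n
    ... | true  | true  | _     = s≤s z≤n
    ... | true  | false | true  = s≤s z≤n
    ... | true  | false | false = ⊥-elim (oriented T w v w≢v (trans wv (sym vw)))

    ∣S∣≤1+∣Out∣+∣In∣ : ∀ S v → ∣ S ∣ ≤ 1 + (∣ Out S v ∣ + ∣ In S v ∣)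
    ∣S∣≤1+∣Out∣+∣In∣ S v = begin
      ∣ S ∣                                                          ≡⟨ ∣S∣≡∑χ S ⟩
      ∑[ w < n ] χ S w                                               ≤⟨ ∑-mono-≤ (χ≤δ+χOut+χIn S v) ⟩
      ∑[ w < n ] (δ v w + (χ (Out S v) w + χ (In S v) w))            ≡⟨ ∑-distrib-+ (δ v) _ ⟩
      ∑[ w < n ] δ v w + ∑[ w < n ] (χ (Out S v) w + χ (In S v) w)   ≡⟨ cong₂ _+_ (∑-δ v) (∑-distrib-+ (χ (Out S v)) (χ (In S v))) ⟩
      1 + (∑[ w < n ] χ (Out S v) w + ∑[ w < n ] χ (In S v) w)       ≡⟨ cong (1 +_) (cong₂ _+_ (∣S∣≡∑χ (Out S v)) (∣S∣≡∑χ (In S v))) ⟨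
      1 + (∣ Out S v ∣ + ∣ In S v ∣)                                  ∎
      where open ≤-Reasoning

    erdősMoser : ∀ k (S : Subset n) → 2 ^ k ≤ ∣ S ∣ → ∃ λ (xs : Vec (Fin n) (suc k)) → Chain xs × All (_∈ S) xs
    erdősMoser zero S 1≤∣S∣ with ∣S∣>0⇒Nonempty S 1≤∣S∣
    ... | v , v∈S = v ∷ [] , [] ∷ [] , v∈S ∷ []
    erdősMoser (suc k) S 2ᵏ⁺¹≤∣S∣ with ∣S∣>0⇒Nonempty S (≤-trans (m^n>0 2 (suc k)) 2ᵏ⁺¹≤∣S∣)
    ... | v , v∈S with 2 ^ k ≤? ∣ Out S v ∣
    ... | yes 2ᵏ≤∣Out∣ with erdősMoser k (Out S v) 2ᵏ≤∣Out∣
    ...   | xs , chain , xs⊆Out = v ∷ xs , All.map (λ x∈Out → ∈⟦⟧⁻ (proj₂ (x∈p∩q⁻ S _ x∈Out))) xs⊆Out ∷ chain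
                                         , v∈S ∷ All.map (λ x∈Out → proj₁ (x∈p∩q⁻ S _ x∈Out)) xs⊆Out
    erdősMoser (suc k) S 2ᵏ⁺¹≤∣S∣ | v , v∈S | no 2ᵏ≰∣Out∣ with erdősMoser k (In S v) 2ᵏ≤∣In∣
      where
      2ᵏ≤∣In∣ : 2 ^ k ≤ ∣ In S v ∣
      2ᵏ≤∣In∣ = +-cancelˡ-≤ (1 + ∣ Out S v ∣) _ _ (begin
        1 + ∣ Out S v ∣ + 2 ^ k        ≤⟨ +-monoˡ-≤ (2 ^ k) (≰⇒> 2ᵏ≰∣Out∣) ⟩
        2 ^ k + 2 ^ k                  ≡⟨ cong (2 ^ k +_) (+-identityʳ (2 ^ k)) ⟨
        2 ^ suc k                      ≤⟨ 2ᵏ⁺¹≤∣S∣ ⟩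
        ∣ S ∣                          ≤⟨ ∣S∣≤1+∣Out∣+∣In∣ S v ⟩
        1 + (∣ Out S v ∣ + ∣ In S v ∣) ≡⟨ +-assoc 1 ∣ Out S v ∣ ∣ In S v ∣ ⟨
        1 + ∣ Out S v ∣ + ∣ In S v ∣   ∎)
        where open ≤-Reasoning
    ... | xs , chain , xs⊆In = xs ∷ʳ v , AllPairs-∷ʳ chain (All.map (λ x∈In → ∈⟦⟧⁻ (proj₂ (x∈p∩q⁻ S _ x∈In))) xs⊆In)
                             , All-∷ʳ (All.map (λ x∈In → proj₁ (x∈p∩q⁻ S _ x∈In)) xs⊆In) v∈S

  module _ {n : ℕ} where

    open import Data.Vec.Membership.DecPropositional (Fin._≟_ {n})
      using () renaming (_∈_ to _∈ᵥ_; _∉_ to _∉ᵥ_; _∈?_ to _∈ᵥ?_)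

    entries : ∀ {m} → Vec (Fin n) m → Subset n
    entries xs = ⟦ (λ w → does (w ∈ᵥ? xs)) ⟧

    ∈entries⁺ : ∀ {m} {xs : Vec (Fin n) m} {w} → w ∈ᵥ xs → w ∈ entries xs
    ∈entries⁺ {xs = xs} {w} w∈xs = ∈⟦⟧⁺ (dec-true (w ∈ᵥ? xs) w∈xs)

    ∈entries⁻ : ∀ {m} {xs : Vec (Fin n) m} {w} → w ∈ entries xs → w ∈ᵥ xs
    ∈entries⁻ {xs = xs} {w} w∈ with w ∈ᵥ? xs | ∈⟦⟧⁻ {p = λ u → does (u ∈ᵥ? xs)} w∈
    ... | yes w∈xs | _ = w∈xs

    entries⊆ : ∀ {m} {xs : Vec (Fin n) m} {S : Subset n} → All (_∈ S) xs → entries xs ⊆ S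
    entries⊆ xs⊆S w∈ = All.lookup xs⊆S (∈entries⁻ w∈)

    χ-entries-∷ : ∀ {m} (v : Fin n) (xs : Vec (Fin n) m) → v ∉ᵥ xs →
                  ∀ w → χ (entries (v ∷ xs)) w ≡ δ v w + χ (entries xs) w
    χ-entries-∷ v xs v∉xs w
      rewrite lookup∘tabulate (λ u → does (u ∈ᵥ? v ∷ xs)) w | lookup∘tabulate (λ u → does (u ∈ᵥ? xs)) w
      with w Fin.≟ v
    ... | yes refl rewrite dec-false (v ∈ᵥ? xs) v∉xs = refl
    ... | no  _    = refl

    ∣entries-∷∣ : ∀ {m} (v : Fin n) (xs : Vec (Fin n) m) → v ∉ᵥ xs → ∣ entries (v ∷ xs) ∣ ≡ suc ∣ entries xs ∣
    ∣entries-∷∣ v xs v∉xs = begin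
      ∣ entries (v ∷ xs) ∣                              ≡⟨ ∣S∣≡∑χ (entries (v ∷ xs)) ⟩
      ∑[ w < n ] χ (entries (v ∷ xs)) w                 ≡⟨ sum-cong-≗ (χ-entries-∷ v xs v∉xs) ⟩
      ∑[ w < n ] (δ v w + χ (entries xs) w)             ≡⟨ ∑-distrib-+ (δ v) (χ (entries xs)) ⟩
      ∑[ w < n ] δ v w + ∑[ w < n ] χ (entries xs) w    ≡⟨ cong₂ _+_ (∑-δ v) (sym (∣S∣≡∑χ (entries xs))) ⟩
      suc ∣ entries xs ∣                                ∎
      where open ≡-Reasoning

    module _ (T : Tournament n) where

      ¬loop : ∀ {v} → adj T v v ≢ true
      ¬loop {v} loop with trans (sym loop) (irrefl T v)
      ... | ()

      head∉tail : ∀ {m} {v} {xs : Vec (Fin n) m} → Chain T (v ∷ xs) → v ∉ᵥ xs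
      head∉tail (v⟶xs ∷ _) v∈xs = ¬loop (All.lookup v⟶xs v∈xs)

      ∣entries∣ : ∀ {m} (xs : Vec (Fin n) m) → Chain T xs → ∣ entries xs ∣ ≡ m
      ∣entries∣ []       _                 =
        trans (∣S∣≡∑χ (entries [])) (trans (sum-cong-≗ (λ w → cong 𝟙 (lookup∘tabulate (λ u → does (u ∈ᵥ? [])) w))) (sum-replicate-zero n))
      ∣entries∣ (v ∷ xs) chain@(_ ∷ chainₓ) = trans (∣entries-∷∣ v xs (head∉tail chain)) (cong suc (∣entries∣ xs chainₓ))

      chain-lookup-injective : ∀ {m} {xs : Vec (Fin n) m} → Chain T xs → ∀ {i j} → lookup xs i ≡ lookup xs j → i ≡ j
      chain-lookup-injective {xs = xs} chain {i} {j} xsᵢ≡xsⱼ with <-cmp (toℕ i) (toℕ j)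
      ... | tri< i<j _ _ = ⊥-elim (¬loop (subst (λ u → adj T (lookup xs i) u ≡ true) (sym xsᵢ≡xsⱼ) (AllPairs-lookup chain i j i<j)))
      ... | tri≈ _ i≡j _ = toℕ-injective i≡j
      ... | tri> _ _ j<i = ⊥-elim (¬loop (subst (λ u → adj T (lookup xs j) u ≡ true) xsᵢ≡xsⱼ (AllPairs-lookup chain j i j<i)))

      chain⇒Transitive : ∀ {m} (xs : Vec (Fin n) m) → Chain T xs → Transitive T (entries xs)
      chain⇒Transitive xs chain = σ , σ-injective , σ∈entries , σ-onto , σ-ordered
        where
        ∣xs∣≡m = ∣entries∣ xs chain
        σ : Fin ∣ entries xs ∣ → Fin n
        σ i = lookup xs (cast ∣xs∣≡m i)
        σ-injective : Injective _≡_ _≡_ σ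
        σ-injective {i} {j} σᵢ≡σⱼ = toℕ-injective (begin
          toℕ i                ≡⟨ toℕ-cast ∣xs∣≡m i ⟨
          toℕ (cast ∣xs∣≡m i)  ≡⟨ cong toℕ (chain-lookup-injective chain σᵢ≡σⱼ) ⟩
          toℕ (cast ∣xs∣≡m j)  ≡⟨ toℕ-cast ∣xs∣≡m j ⟩
          toℕ j                ∎)
          where open ≡-Reasoning
        σ∈entries : ∀ i → σ i ∈ entries xs
        σ∈entries i = ∈entries⁺ (∈-lookup (cast ∣xs∣≡m i) xs)
        σ-onto : ∀ w → w ∈ entries xs → ∃ λ i → σ i ≡ w
        σ-onto w w∈ = cast (sym ∣xs∣≡m) (index w∈xs)
                    , trans (cong (lookup xs) (cast-involutive ∣xs∣≡m (sym ∣xs∣≡m) (index w∈xs))) (sym (lookup-index w∈xs))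
          where w∈xs = ∈entries⁻ {xs = xs} w∈
        σ-ordered : ∀ i j → i Fin.< j → adj T (σ i) (σ j) ≡ true
        σ-ordered i j i<j = AllPairs-lookup chain _ _ (subst₂ _<_ (sym (toℕ-cast ∣xs∣≡m i)) (sym (toℕ-cast ∣xs∣≡m j)) i<j)

  -- The power-mean inequality

  a*[m+c]+b*m≤m*a+[m+c]*b : ∀ a b m c → a ≤ b → a * (m + c) + b * m ≤ m * a + (m + c) * b
  a*[m+c]+b*m≤m*a+[m+c]*b a b m c a≤b = begin
    a * (m + c) + b * m     ≡⟨ lhs a b m c ⟩
    a * m + b * m + a * c   ≤⟨ +-monoʳ-≤ (a * m + b * m) (*-monoˡ-≤ c a≤b) ⟩
    a * m + b * m + b * c   ≡⟨ rhs a b m c ⟩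
    m * a + (m + c) * b     ∎
    where
    open ≤-Reasoning
    lhs : ∀ a b m c → a * (m + c) + b * m ≡ a * m + b * m + a * c
    lhs = solve-∀
    rhs : ∀ a b m c → a * m + b * m + b * c ≡ m * a + (m + c) * b
    rhs = solve-∀

  m≤n⇒m^o*n+n^o*m≤m^[1+o]+n^[1+o] : ∀ o {m n} → m ≤ n → m ^ o * n + n ^ o * m ≤ m ^ suc o + n ^ suc o
  m≤n⇒m^o*n+n^o*m≤m^[1+o]+n^[1+o] o {m} {n} m≤n with n ∸ m | m+[n∸m]≡n m≤n
  ... | c | refl = a*[m+c]+b*m≤m*a+[m+c]*b (m ^ o) ((m + c) ^ o) m c (^-monoˡ-≤ o (m≤m+n m c))

  m^o*n+n^o*m≤m^[1+o]+n^[1+o] : ∀ o m n → m ^ o * n + n ^ o * m ≤ m ^ suc o + n ^ suc o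
  m^o*n+n^o*m≤m^[1+o]+n^[1+o] o m n with ≤-total m n
  ... | inj₁ m≤n = m≤n⇒m^o*n+n^o*m≤m^[1+o]+n^[1+o] o m≤n
  ... | inj₂ n≤m = subst₂ _≤_ (+-comm (n ^ o * m) (m ^ o * n)) (+-comm (n ^ suc o) (m ^ suc o))
                          (m≤n⇒m^o*n+n^o*m≤m^[1+o]+n^[1+o] o n≤m)

  m+m≤n+n⇒m≤n : ∀ {m n} → m + m ≤ n + n → m ≤ n
  m+m≤n+n⇒m≤n {m} {n} m+m≤n+n with m ≤? n
  ... | yes m≤n = m≤n
  ... | no  m≰n = contradiction m+m≤n+n (<⇒≱ (+-mono-< (≰⇒> m≰n) (≰⇒> m≰n)))

  ∑*∑ : ∀ {n} (f g : Fin n → ℕ) → (∑[ a < n ] f a) * (∑[ b < n ] g b) ≡ ∑[ a < n ] ∑[ b < n ] (f a * g b)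
  ∑*∑ f g = trans (*-distribʳ-sum _ f) (sum-cong-≗ (λ a → *-distribˡ-sum (f a) g))

  ∑∑+∑∑≡∑∑-sym : ∀ {n} (F : Fin n → Fin n → ℕ) →
    ∑[ a < n ] ∑[ b < n ] F a b + ∑[ a < n ] ∑[ b < n ] F a b ≡ ∑[ a < n ] ∑[ b < n ] (F a b + F b a)
  ∑∑+∑∑≡∑∑-sym {n} F = begin
    ∑[ a < n ] ∑[ b < n ] F a b + ∑[ a < n ] ∑[ b < n ] F a b   ≡⟨ cong (∑[ a < n ] ∑[ b < n ] F a b +_) (∑-comm F) ⟩
    ∑[ a < n ] ∑[ b < n ] F a b + ∑[ a < n ] ∑[ b < n ] F b a   ≡⟨ ∑-distrib-+ (λ a → ∑[ b < n ] F a b) _ ⟨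
    ∑[ a < n ] (∑[ b < n ] F a b + ∑[ b < n ] F b a)           ≡⟨ sum-cong-≗ (λ a → ∑-distrib-+ (F a) (λ b → F b a)) ⟨
    ∑[ a < n ] ∑[ b < n ] (F a b + F b a)                       ∎
    where open ≡-Reasoning

  module _ {n : ℕ} (w d : Fin n → ℕ) where

    chebyshev : ∀ s → (∑[ a < n ] (w a * d a ^ s)) * (∑[ a < n ] (w a * d a))
                      ≤ (∑[ a < n ] w a) * (∑[ a < n ] (w a * d a ^ suc s))
    chebyshev s = m+m≤n+n⇒m≤n (begin
      L + L                                  ≡⟨ cong₂ _+_ L≡ L≡ ⟩
      ∑∑ F + ∑∑ F                            ≡⟨ ∑∑+∑∑≡∑∑-sym F ⟩
      ∑[ a < n ] ∑[ b < n ] (F a b + F b a)  ≤⟨ ∑-mono-≤ (λ a → ∑-mono-≤ (λ b → F+F≤H+H a b)) ⟩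
      ∑[ a < n ] ∑[ b < n ] (H a b + H b a)  ≡⟨ ∑∑+∑∑≡∑∑-sym H ⟨
      ∑∑ H + ∑∑ H                            ≡⟨ cong₂ _+_ R≡ R≡ ⟨
      R + R                                  ∎)
      where
      open ≤-Reasoning
      ∑∑ : (Fin n → Fin n → ℕ) → ℕ
      ∑∑ F = ∑[ a < n ] ∑[ b < n ] F a b
      L = (∑[ a < n ] (w a * d a ^ s)) * (∑[ a < n ] (w a * d a))
      R = (∑[ a < n ] w a) * (∑[ a < n ] (w a * d a ^ suc s))
      F H : Fin n → Fin n → ℕ
      F a b = (w a * d a ^ s) * (w b * d b)
      H a b = w a * (w b * d b ^ suc s)
      L≡ : L ≡ ∑∑ F
      L≡ = ∑*∑ (λ a → w a * d a ^ s) (λ b → w b * d b)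
      R≡ : R ≡ ∑∑ H
      R≡ = ∑*∑ w (λ b → w b * d b ^ suc s)
      F+F≤H+H : ∀ a b → F a b + F b a ≤ H a b + H b a
      F+F≤H+H a b = begin
        F a b + F b a                                 ≡⟨ pairF (w a) (w b) (d a ^ s) (d b ^ s) (d a) (d b) ⟩
        (w a * w b) * (d a ^ s * d b + d b ^ s * d a) ≤⟨ *-monoʳ-≤ (w a * w b) (m^o*n+n^o*m≤m^[1+o]+n^[1+o] s (d a) (d b)) ⟩
        (w a * w b) * (d a ^ suc s + d b ^ suc s)     ≡⟨ pairH (w a) (w b) (d a ^ s) (d b ^ s) (d a) (d b) ⟩
        H a b + H b a                                 ∎
        where
        pairF : ∀ wa wb xa xb da db → (wa * xa) * (wb * db) + (wb * xb) * (wa * da) ≡ (wa * wb) * (xa * db + xb * da)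
        pairF = solve-∀
        pairH : ∀ wa wb xa xb da db → (wa * wb) * (da * xa + db * xb) ≡ wa * (wb * (db * xb)) + wb * (wa * (da * xa))
        pairH = solve-∀

    power-mean : ∀ s → (∑[ a < n ] (w a * d a)) ^ suc s ≤ (∑[ a < n ] w a) ^ s * ∑[ a < n ] (w a * d a ^ suc s)
    power-mean zero = begin
      Sd * 1                  ≡⟨ *-identityʳ Sd ⟩
      Sd                      ≡⟨ sum-cong-≗ (λ a → cong (w a *_) (*-identityʳ (d a))) ⟨
      ∑[ a < n ] (w a * d a ^ 1) ≡⟨ +-identityʳ _ ⟨
      1 * ∑[ a < n ] (w a * d a ^ 1) ∎
      where
      open ≤-Reasoning
      Sd = ∑[ a < n ] (w a * d a)
    power-mean (suc s) = begin
      Sd * Sd ^ suc s         ≤⟨ *-monoʳ-≤ Sd (power-mean s) ⟩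
      Sd * (Sw ^ s * S₁)      ≡⟨ rearrange₁ Sd (Sw ^ s) S₁ ⟩
      Sw ^ s * (S₁ * Sd)      ≤⟨ *-monoʳ-≤ (Sw ^ s) (chebyshev (suc s)) ⟩
      Sw ^ s * (Sw * S₂)      ≡⟨ rearrange₂ (Sw ^ s) Sw S₂ ⟩
      Sw * Sw ^ s * S₂        ∎
      where
      open ≤-Reasoning
      Sd = ∑[ a < n ] (w a * d a)
      Sw = ∑[ a < n ] w a
      S₁ = ∑[ a < n ] (w a * d a ^ suc s)
      S₂ = ∑[ a < n ] (w a * d a ^ suc (suc s))
      rearrange₁ : ∀ x y z → x * (y * z) ≡ y * (z * x)
      rearrange₁ = solve-∀
      rearrange₂ : ∀ x y z → x * (y * z) ≡ y * x * z
      rearrange₂ = solve-∀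

  -- Passing to a subset of prescribed size without lowering the average

  ratio-trans : ∀ a b c d e f .{{_ : NonZero d}} → a * d ≤ c * b → c * f ≤ e * d → a * f ≤ e * b
  ratio-trans a b c d e f ad≤cb cf≤ed = *-cancelʳ-≤ (a * f) (e * b) d (begin
    a * f * d    ≡⟨ swap a f d ⟩
    a * d * f    ≤⟨ *-monoˡ-≤ f ad≤cb ⟩
    c * b * f    ≡⟨ swap c b f ⟩
    c * f * b    ≤⟨ *-monoˡ-≤ b cf≤ed ⟩
    e * d * b    ≡⟨ swap e d b ⟩
    e * b * d    ∎)
    where
    open ≤-Reasoning
    swap : ∀ x y z → x * y * z ≡ x * z * y
    swap = solve-∀

  module _ {n : ℕ} (d : Fin n → ℕ) where

    weight : Subset n → ℕ
    weight S = ∑[ a < n ] (χ S a * d a)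

    ∃≤average : ∀ A → 0 < ∣ A ∣ → ∃ λ v → v ∈ A × d v * ∣ A ∣ ≤ weight A
    ∃≤average A 0<∣A∣ with ∑-<⇒∃< (λ a → χ A a * (d a * ∣ A ∣)) (λ a → χ A a * suc (weight A)) ∑<∑
      where
      ∑<∑ : ∑[ a < n ] (χ A a * (d a * ∣ A ∣)) < ∑[ a < n ] (χ A a * suc (weight A))
      ∑<∑ = begin-strict
        ∑[ a < n ] (χ A a * (d a * ∣ A ∣))  ≡⟨ sum-cong-≗ (λ a → *-assoc (χ A a) (d a) ∣ A ∣) ⟨
        ∑[ a < n ] (χ A a * d a * ∣ A ∣)    ≡⟨ *-distribʳ-sum ∣ A ∣ (λ a → χ A a * d a) ⟨
        weight A * ∣ A ∣                    <⟨ m<m+n (weight A * ∣ A ∣) 0<∣A∣ ⟩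
        weight A * ∣ A ∣ + ∣ A ∣            ≡⟨ +-comm (weight A * ∣ A ∣) ∣ A ∣ ⟩
        suc (weight A) * ∣ A ∣              ≡⟨ *-comm (suc (weight A)) ∣ A ∣ ⟩
        ∣ A ∣ * suc (weight A)              ≡⟨ cong (_* suc (weight A)) (∣S∣≡∑χ A) ⟩
        (∑[ a < n ] χ A a) * suc (weight A) ≡⟨ *-distribʳ-sum (suc (weight A)) (χ A) ⟩
        ∑[ a < n ] (χ A a * suc (weight A)) ∎
        where open ≤-Reasoning
    ... | v , below with lookup A v in v∈A
    ... | true = v , lookup⇒[]= v A v∈A , ≤-pred (subst₂ _<_ (+-identityʳ _) (+-identityʳ _) below)

    _∖_ : Subset n → Fin n → Subset n
    A ∖ v = A ∩ ⟦ (λ w → not (does (w Fin.≟ v))) ⟧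

    ∖⊆ : ∀ A v → A ∖ v ⊆ A
    ∖⊆ A v w∈ = proj₁ (x∈p∩q⁻ A _ w∈)

    χ-∖ : ∀ {A v} → v ∈ A → ∀ w → χ A w ≡ χ (A ∖ v) w + δ v w
    χ-∖ {A} {v} v∈A w rewrite χ-∩⟦⟧ A (λ u → not (does (u Fin.≟ v))) w with w Fin.≟ v
    ... | yes refl rewrite ∈⇒χ≡1 v∈A = refl
    ... | no  _    = sym (trans (+-identityʳ _) (*-identityʳ (χ A w)))

    ∣∖∣ : ∀ {A v} → v ∈ A → ∣ A ∣ ≡ suc ∣ A ∖ v ∣
    ∣∖∣ {A} {v} v∈A = begin
      ∣ A ∣                                            ≡⟨ ∣S∣≡∑χ A ⟩
      ∑[ w < n ] χ A w                                 ≡⟨ sum-cong-≗ (χ-∖ v∈A) ⟩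
      ∑[ w < n ] (χ (A ∖ v) w + δ v w)                 ≡⟨ ∑-distrib-+ (χ (A ∖ v)) (δ v) ⟩
      ∑[ w < n ] χ (A ∖ v) w + ∑[ w < n ] δ v w        ≡⟨ cong₂ _+_ (sym (∣S∣≡∑χ (A ∖ v))) (∑-δ v) ⟩
      ∣ A ∖ v ∣ + 1                                    ≡⟨ +-comm ∣ A ∖ v ∣ 1 ⟩
      suc ∣ A ∖ v ∣                                    ∎
      where open ≡-Reasoning

    weight-∖ : ∀ {A v} → v ∈ A → weight A ≡ weight (A ∖ v) + d v
    weight-∖ {A} {v} v∈A = begin
      ∑[ w < n ] (χ A w * d w)                                  ≡⟨ sum-cong-≗ (λ w → cong (_* d w) (χ-∖ v∈A w)) ⟩
      ∑[ w < n ] ((χ (A ∖ v) w + δ v w) * d w)                  ≡⟨ sum-cong-≗ (λ w → *-distribʳ-+ (d w) (χ (A ∖ v) w) (δ v w)) ⟩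
      ∑[ w < n ] (χ (A ∖ v) w * d w + δ v w * d w)              ≡⟨ ∑-distrib-+ (λ w → χ (A ∖ v) w * d w) (λ w → δ v w * d w) ⟩
      weight (A ∖ v) + ∑[ w < n ] (δ v w * d w)                 ≡⟨ cong (weight (A ∖ v) +_) (∑-δ* v d) ⟩
      weight (A ∖ v) + d v                                      ∎
      where open ≡-Reasoning

    removing-light-vertex : ∀ {A v} → v ∈ A → d v * ∣ A ∣ ≤ weight A → weight A * ∣ A ∖ v ∣ ≤ weight (A ∖ v) * ∣ A ∣
    removing-light-vertex {A} {v} v∈A light = +-cancelʳ-≤ (d v * ∣ A ∣) _ _ (begin
      weight A * ∣ A ∖ v ∣ + d v * ∣ A ∣    ≤⟨ +-monoʳ-≤ (weight A * ∣ A ∖ v ∣) light ⟩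
      weight A * ∣ A ∖ v ∣ + weight A       ≡⟨ +-comm (weight A * ∣ A ∖ v ∣) (weight A) ⟩
      weight A + weight A * ∣ A ∖ v ∣       ≡⟨ *-suc (weight A) ∣ A ∖ v ∣ ⟨
      weight A * suc ∣ A ∖ v ∣              ≡⟨ cong (weight A *_) (∣∖∣ v∈A) ⟨
      weight A * ∣ A ∣                      ≡⟨ cong (_* ∣ A ∣) (weight-∖ v∈A) ⟩
      (weight (A ∖ v) + d v) * ∣ A ∣        ≡⟨ *-distribʳ-+ ∣ A ∣ (weight (A ∖ v)) (d v) ⟩
      weight (A ∖ v) * ∣ A ∣ + d v * ∣ A ∣  ∎)
      where open ≤-Reasoning

    average-preserving-subset : ∀ m g A → 0 < m → ∣ A ∣ ≡ m + g →
      ∃ λ A' → A' ⊆ A × ∣ A' ∣ ≡ m × weight A * m ≤ weight A' * ∣ A ∣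
    average-preserving-subset m zero A 0<m ∣A∣≡m+0 =
      A , id , ∣A∣≡m , ≤-reflexive (cong (weight A *_) (sym ∣A∣≡m))
      where ∣A∣≡m = trans ∣A∣≡m+0 (+-identityʳ m)
    average-preserving-subset m (suc g) A 0<m ∣A∣≡m+1+g
      with ∃≤average A (≤-trans 0<m (≤-trans (m≤m+n m (suc g)) (≤-reflexive (sym ∣A∣≡m+1+g))))
    ... | v , v∈A , light = step (average-preserving-subset m g (A ∖ v) 0<m ∣A∖v∣≡m+g)
      where
      ∣A∖v∣≡m+g : ∣ A ∖ v ∣ ≡ m + g
      ∣A∖v∣≡m+g = suc-injective (trans (sym (∣∖∣ v∈A)) (trans ∣A∣≡m+1+g (+-suc m g)))
      instance
        ∣A∖v∣≢0 : NonZero ∣ A ∖ v ∣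
        ∣A∖v∣≢0 = >-nonZero (≤-trans 0<m (≤-trans (m≤m+n m g) (≤-reflexive (sym ∣A∖v∣≡m+g))))
      step : (∃ λ A' → A' ⊆ A ∖ v × ∣ A' ∣ ≡ m × weight (A ∖ v) * m ≤ weight A' * ∣ A ∖ v ∣) →
             ∃ λ A' → A' ⊆ A × ∣ A' ∣ ≡ m × weight A * m ≤ weight A' * ∣ A ∣
      step (A' , A'⊆A∖v , ∣A'∣≡m , average≤) =
        A' , ∖⊆ A v ∘ A'⊆A∖v , ∣A'∣≡m ,
        ratio-trans (weight A) (∣ A ∣) (weight (A ∖ v)) (∣ A ∖ v ∣) (weight A') m (removing-light-vertex v∈A light) average≤

  -- Dependent random choice

  n≤1+pred[n] : ∀ n → n ≤ suc (pred n)
  n≤1+pred[n] zero    = z≤n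
  n≤1+pred[n] (suc n) = ≤-refl

  All-transpose : ∀ {A B : Set} {P : A → B → Set} {k t} {xs : Vec A k} {ys : Vec B t} →
                  All (λ x → All (P x) ys) xs → All (λ y → All (λ x → P x y) xs) ys
  All-transpose Pxsys = lookup⁻ (λ j → lookup⁻ (λ i → lookup⁺ (lookup⁺ Pxsys i) j))

  𝟙[c<ᵇK]≡0⇒K≤c : ∀ c K → 𝟙 (c <ᵇ K) ≡ 0 → K ≤ c
  𝟙[c<ᵇK]≡0⇒K≤c c K _ with c <ᵇ K in c<ᵇK
  ... | false = ≮⇒≥ (λ c<K → subst T c<ᵇK (<⇒<ᵇ c<K))

  𝟙[c<ᵇK]*a*c^t≤a*K^t : ∀ c K a t → 𝟙 (c <ᵇ K) * a * c ^ t ≤ a * K ^ t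
  𝟙[c<ᵇK]*a*c^t≤a*K^t c K a t with c <ᵇ K in c<ᵇK
  ... | false = z≤n
  ... | true  = subst (_≤ a * K ^ t) (cong (_* c ^ t) (sym (+-identityʳ a)))
                      (*-monoʳ-≤ a (^-monoˡ-≤ t (<⇒≤ (<ᵇ⇒< c K (subst T (sym c<ᵇK) tt)))))

  module _ {n : ℕ} (R : Fin n → Fin n → Bool) (B : Subset n) where

    commonOut : ∀ {k} → Vec (Fin n) k → Subset n
    commonOut xs = B ∩ ⟦ (λ v → allᵇ (λ a → R a v) xs) ⟧

    module _ (A : Subset n) (k t K : ℕ) where

      dominators : Vec (Fin n) t → Subset n
      dominators τ = A ∩ ⟦ (λ a → τ ⊆ᵇ outNeighbours R B a) ⟧

      badCount : Vec (Fin n) t → ℕ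
      badCount τ = ∑ᵥ k (λ xs → 𝟙 (∣ commonOut xs ∣ <ᵇ K) * 𝟙 (xs ⊆ᵇ A) * 𝟙 (τ ⊆ᵇ commonOut xs))

      ∑∣dominators∣ : ∑ᵥ t (λ τ → ∣ dominators τ ∣) ≡ ∑[ a < n ] (χ A a * ∣ outNeighbours R B a ∣ ^ t)
      ∑∣dominators∣ = begin
        ∑ᵥ t (λ τ → ∣ dominators τ ∣)                                     ≡⟨ ∑ᵥ-cong t (λ τ → ∣∩⟦⟧∣ A (λ a → τ ⊆ᵇ outNeighbours R B a)) ⟩
        ∑ᵥ t (λ τ → ∑[ a < n ] (χ A a * 𝟙 (τ ⊆ᵇ outNeighbours R B a)))         ≡⟨ ∑ᵥ-∑-comm t (λ a τ → χ A a * 𝟙 (τ ⊆ᵇ outNeighbours R B a)) ⟩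
        ∑[ a < n ] ∑ᵥ t (λ τ → χ A a * 𝟙 (τ ⊆ᵇ outNeighbours R B a))           ≡⟨ sum-cong-≗ (λ a → *-distribˡ-∑ᵥ t (χ A a) _) ⟨
        ∑[ a < n ] (χ A a * ∑ᵥ t (λ τ → 𝟙 (τ ⊆ᵇ outNeighbours R B a)))         ≡⟨ sum-cong-≗ (λ a → cong (χ A a *_) (∑ᵥ-⊆ᵇ t (outNeighbours R B a))) ⟩
        ∑[ a < n ] (χ A a * ∣ outNeighbours R B a ∣ ^ t)                       ∎
        where open ≡-Reasoning

      ∑badCount≤ : ∑ᵥ t badCount ≤ ∣ A ∣ ^ k * K ^ t
      ∑badCount≤ = begin
        ∑ᵥ t badCount
          ≡⟨ ∑ᵥ-comm t k (λ τ xs → bad xs * 𝟙 (xs ⊆ᵇ A) * 𝟙 (τ ⊆ᵇ commonOut xs)) ⟩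
        ∑ᵥ k (λ xs → ∑ᵥ t (λ τ → bad xs * 𝟙 (xs ⊆ᵇ A) * 𝟙 (τ ⊆ᵇ commonOut xs)))
          ≡⟨ ∑ᵥ-cong k (λ xs → *-distribˡ-∑ᵥ t (bad xs * 𝟙 (xs ⊆ᵇ A)) _) ⟨
        ∑ᵥ k (λ xs → bad xs * 𝟙 (xs ⊆ᵇ A) * ∑ᵥ t (λ τ → 𝟙 (τ ⊆ᵇ commonOut xs)))
          ≡⟨ ∑ᵥ-cong k (λ xs → cong (bad xs * 𝟙 (xs ⊆ᵇ A) *_) (∑ᵥ-⊆ᵇ t (commonOut xs))) ⟩
        ∑ᵥ k (λ xs → bad xs * 𝟙 (xs ⊆ᵇ A) * ∣ commonOut xs ∣ ^ t)
          ≤⟨ ∑ᵥ-mono-≤ k (λ xs → 𝟙[c<ᵇK]*a*c^t≤a*K^t ∣ commonOut xs ∣ K (𝟙 (xs ⊆ᵇ A)) t) ⟩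
        ∑ᵥ k (λ xs → 𝟙 (xs ⊆ᵇ A) * K ^ t)
          ≡⟨ *-distribʳ-∑ᵥ k (K ^ t) (λ xs → 𝟙 (xs ⊆ᵇ A)) ⟨
        ∑ᵥ k (λ xs → 𝟙 (xs ⊆ᵇ A)) * K ^ t
          ≡⟨ cong (_* K ^ t) (∑ᵥ-⊆ᵇ k A) ⟩
        ∣ A ∣ ^ k * K ^ t ∎
        where
        open ≤-Reasoning
        bad : Vec (Fin n) k → ℕ
        bad xs = 𝟙 (∣ commonOut xs ∣ <ᵇ K)

      ∣dominators∣≤∣A∣*𝟙[τ⊆B] : ∀ τ → ∣ dominators τ ∣ ≤ ∣ A ∣ * 𝟙 (τ ⊆ᵇ B)
      ∣dominators∣≤∣A∣*𝟙[τ⊆B] τ = begin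
        ∣ dominators τ ∣                                  ≡⟨ ∣∩⟦⟧∣ A (λ a → τ ⊆ᵇ outNeighbours R B a) ⟩
        ∑[ a < n ] (χ A a * 𝟙 (τ ⊆ᵇ outNeighbours R B a))     ≤⟨ ∑-mono-≤ (λ a → *-monoʳ-≤ (χ A a) (𝟙-⊆ᵇ-mono τ (p∩q⊆p B ⟦ R a ⟧))) ⟩
        ∑[ a < n ] (χ A a * 𝟙 (τ ⊆ᵇ B))                   ≡⟨ *-distribʳ-sum (𝟙 (τ ⊆ᵇ B)) (χ A) ⟨
        (∑[ a < n ] χ A a) * 𝟙 (τ ⊆ᵇ B)                   ≡⟨ cong (_* 𝟙 (τ ⊆ᵇ B)) (∣S∣≡∑χ A) ⟨
        ∣ A ∣ * 𝟙 (τ ⊆ᵇ B)                                ∎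
        where open ≤-Reasoning

      dominators-have-large-commonOut : ∀ τ → τ ⊆ᵇ B ≡ true → badCount τ ≡ 0 →
                                        ∀ xs → All (_∈ dominators τ) xs → K ≤ ∣ commonOut xs ∣
      dominators-have-large-commonOut τ τ⊆ᵇB badCount≡0 xs xs⊆Dτ = 𝟙[c<ᵇK]≡0⇒K≤c ∣ commonOut xs ∣ K (n≤0⇒n≡0 (begin
        𝟙 (∣ commonOut xs ∣ <ᵇ K)                                         ≡⟨ *-identityʳ _ ⟨
        𝟙 (∣ commonOut xs ∣ <ᵇ K) * 1                                     ≡⟨ *-identityʳ _ ⟨
        𝟙 (∣ commonOut xs ∣ <ᵇ K) * 1 * 1                                 ≡⟨ cong₂ (λ a b → 𝟙 (∣ commonOut xs ∣ <ᵇ K) * 𝟙 a * 𝟙 b) xs⊆ᵇA τ⊆ᵇcommonOut ⟨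
        𝟙 (∣ commonOut xs ∣ <ᵇ K) * 𝟙 (xs ⊆ᵇ A) * 𝟙 (τ ⊆ᵇ commonOut xs)  ≤⟨ term≤∑ᵥ k _ xs ⟩
        badCount τ                                                        ≡⟨ badCount≡0 ⟩
        0                                                                 ∎))
        where
        open ≤-Reasoning
        xs⊆ᵇA : xs ⊆ᵇ A ≡ true
        xs⊆ᵇA = ⊆ᵇ⁺ (All.map (λ a∈Dτ → proj₁ (x∈p∩q⁻ A _ a∈Dτ)) xs⊆Dτ)
        xs⟶τ : All (λ v → All (λ a → R a v ≡ true) xs) τ
        xs⟶τ = All-transpose (All.map (λ a∈Dτ → All.map (λ v∈N⁺a → ∈⟦⟧⁻ (proj₂ (x∈p∩q⁻ B _ v∈N⁺a)))
                                                         (⊆ᵇ⁻ (∈⟦⟧⁻ (proj₂ (x∈p∩q⁻ A _ a∈Dτ)))))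
                                      xs⊆Dτ)
        τ⊆ᵇcommonOut : τ ⊆ᵇ commonOut xs ≡ true
        τ⊆ᵇcommonOut = ⊆ᵇ⁺ {S = commonOut xs} (All.map (λ { (v∈B , xs⟶v) → x∈p∩q⁺ (v∈B , ∈⟦⟧⁺ (allᵇ⁺ xs⟶v)) })
                                                        (All.zip (⊆ᵇ⁻ {S = B} τ⊆ᵇB , xs⟶τ)))

      threshold : Vec (Fin n) t → ℕ
      threshold τ = pred K * 𝟙 (τ ⊆ᵇ B) + ∣ A ∣ * badCount τ

      ∑threshold<∑∣dominators∣ : pred K * ∣ B ∣ ^ t + ∣ A ∣ * (∣ A ∣ ^ k * K ^ t) < ∑[ a < n ] (χ A a * ∣ outNeighbours R B a ∣ ^ t) →
                                 ∑ᵥ t threshold < ∑ᵥ t (λ τ → ∣ dominators τ ∣)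
      ∑threshold<∑∣dominators∣ hyp = begin-strict
        ∑ᵥ t threshold
          ≡⟨ ∑ᵥ-distrib-+ t (λ τ → pred K * 𝟙 (τ ⊆ᵇ B)) (λ τ → ∣ A ∣ * badCount τ) ⟩
        ∑ᵥ t (λ τ → pred K * 𝟙 (τ ⊆ᵇ B)) + ∑ᵥ t (λ τ → ∣ A ∣ * badCount τ)
          ≡⟨ cong₂ _+_ (*-distribˡ-∑ᵥ t (pred K) (λ τ → 𝟙 (τ ⊆ᵇ B))) (*-distribˡ-∑ᵥ t ∣ A ∣ badCount) ⟨
        pred K * ∑ᵥ t (λ τ → 𝟙 (τ ⊆ᵇ B)) + ∣ A ∣ * ∑ᵥ t badCount
          ≤⟨ +-mono-≤ (≤-reflexive (cong (pred K *_) (∑ᵥ-⊆ᵇ t B))) (*-monoʳ-≤ ∣ A ∣ ∑badCount≤) ⟩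
        pred K * ∣ B ∣ ^ t + ∣ A ∣ * (∣ A ∣ ^ k * K ^ t)
          <⟨ hyp ⟩
        ∑[ a < n ] (χ A a * ∣ outNeighbours R B a ∣ ^ t)
          ≡⟨ ∑∣dominators∣ ⟨
        ∑ᵥ t (λ τ → ∣ dominators τ ∣) ∎
        where open ≤-Reasoning

      -- At a τ beating the threshold, τ ⊆ B (otherwise τ has no dominators), hence badCount τ = 0
      -- (each bad tuple costs |A| ≥ |dominators τ|) and |dominators τ| ≥ K.
      dependentRandomChoice :
        pred K * ∣ B ∣ ^ t + ∣ A ∣ * (∣ A ∣ ^ k * K ^ t) < ∑[ a < n ] (χ A a * ∣ outNeighbours R B a ∣ ^ t) →
        ∃ λ U → U ⊆ A × K ≤ ∣ U ∣ × (∀ (xs : Vec (Fin n) k) → All (_∈ U) xs → K ≤ ∣ commonOut xs ∣)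
      dependentRandomChoice hyp with ∑ᵥ-<⇒∃< t threshold (λ τ → ∣ dominators τ ∣) (∑threshold<∑∣dominators∣ hyp)
      ... | τ , θτ<∣Dτ∣ = dominators τ , p∩q⊆p A _ , K≤∣Dτ∣ ,
                          dominators-have-large-commonOut τ (𝟙≡1⇒≡true 𝟙[τ⊆B]≡1) badCount≡0
        where
        open ≤-Reasoning
        𝟙[τ⊆B]≡1 : 𝟙 (τ ⊆ᵇ B) ≡ 1
        𝟙[τ⊆B]≡1 with τ ⊆ᵇ B | ∣dominators∣≤∣A∣*𝟙[τ⊆B] τ
        ... | true  | _          = refl
        ... | false | ∣Dτ∣≤∣A∣*0 = contradiction (<-≤-trans θτ<∣Dτ∣ (≤-trans ∣Dτ∣≤∣A∣*0 (≤-reflexive (*-zeroʳ ∣ A ∣)))) n≮0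
        badCount≡0 : badCount τ ≡ 0
        badCount≡0 = n<1⇒n≡0 (*-cancelˡ-< ∣ A ∣ _ _ (begin-strict
          ∣ A ∣ * badCount τ  ≤⟨ m≤n+m _ _ ⟩
          threshold τ         <⟨ θτ<∣Dτ∣ ⟩
          ∣ dominators τ ∣    ≤⟨ ∣dominators∣≤∣A∣*𝟙[τ⊆B] τ ⟩
          ∣ A ∣ * 𝟙 (τ ⊆ᵇ B)  ≡⟨ cong (∣ A ∣ *_) 𝟙[τ⊆B]≡1 ⟩
          ∣ A ∣ * 1           ∎))
        K≤∣Dτ∣ : K ≤ ∣ dominators τ ∣
        K≤∣Dτ∣ = begin
          K                          ≤⟨ n≤1+pred[n] K ⟩
          suc (pred K)               ≡⟨ cong suc (*-identityʳ (pred K)) ⟨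
          suc (pred K * 1)           ≡⟨ cong (λ z → suc (pred K * z)) 𝟙[τ⊆B]≡1 ⟨
          suc (pred K * 𝟙 (τ ⊆ᵇ B))  ≤⟨ s≤s (m≤m+n _ _) ⟩
          suc (threshold τ)          ≤⟨ θτ<∣Dτ∣ ⟩
          ∣ dominators τ ∣           ∎

  module _ {n : ℕ} (T : Tournament n) where

    TransitivePair : ℕ → Subset n → Subset n → Set
    TransitivePair k A B = ∃₂ λ X Y → X ⊆ A × Y ⊆ B × ∣ X ∣ ≡ k × ∣ Y ∣ ≡ k
                           × Transitive T X × Transitive T Y × (∀ a b → a ∈ X → b ∈ Y → adj T a b ≡ true)

    transitivePair : ∀ j t (A B : Subset n) →
      pred (2 ^ j) * ∣ B ∣ ^ t + ∣ A ∣ * (∣ A ∣ ^ suc j * (2 ^ j) ^ t)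
        < ∑[ a < n ] (χ A a * ∣ outNeighbours (adj T) B a ∣ ^ t) →
      TransitivePair (suc j) A B
    transitivePair j t A B hyp = fromDominators (dependentRandomChoice (adj T) B A (suc j) t (2 ^ j) hyp)
      where
      fromChains : ∀ xs ys → Chain T xs → Chain T ys → entries xs ⊆ A → All (_∈ commonOut (adj T) B xs) ys →
                   TransitivePair (suc j) A B
      fromChains xs ys chainₓ chainᵧ X⊆A ys⊆common =
        entries xs , entries ys , X⊆A , (p∩q⊆p B _ ∘ entries⊆ ys⊆common) ,
        ∣entries∣ T xs chainₓ , ∣entries∣ T ys chainᵧ ,
        chain⇒Transitive T xs chainₓ , chain⇒Transitive T ys chainᵧ , xs⟶ys
        where
        xs⟶ys : ∀ a b → a ∈ entries xs → b ∈ entries ys → adj T a b ≡ true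
        xs⟶ys a b a∈X b∈Y = All.lookup (allᵇ⁻ xs (∈⟦⟧⁻ (proj₂ (x∈p∩q⁻ B _ (entries⊆ ys⊆common b∈Y))))) (∈entries⁻ {xs = xs} a∈X)
      fromDominators : (∃ λ U → U ⊆ A × 2 ^ j ≤ ∣ U ∣ × (∀ (xs : Vec (Fin n) (suc j)) → All (_∈ U) xs → 2 ^ j ≤ ∣ commonOut (adj T) B xs ∣)) →
                       TransitivePair (suc j) A B
      fromDominators (U , U⊆A , 2ʲ≤∣U∣ , large) =
        let (xs , chainₓ , xs⊆U) = erdősMoser T j U 2ʲ≤∣U∣
            (ys , chainᵧ , ys⊆common) = erdősMoser T j (commonOut (adj T) B xs) (large xs xs⊆U)
        in fromChains xs ys chainₓ chainᵧ (U⊆A ∘ entries⊆ xs⊆U) ys⊆common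

  -- The parameters t = 2k and K = 2^(k-1)

  2p≤q⇒q≢0 : ∀ {p q} .{{_ : NonZero p}} → 2 * p ≤ q → NonZero q
  2p≤q⇒q≢0 {p} 2p≤q = >-nonZero (≤-trans (>-nonZero⁻¹ p) (≤-trans (m≤n*m p 2) 2p≤q))

  q^e≤p^e*N⇒N≢0 : ∀ {p q N} e .{{_ : NonZero q}} → q ^ e ≤ p ^ e * N → NonZero N
  q^e≤p^e*N⇒N≢0 {p} {q} e q^e≤ = ≢-nonZero λ { refl → <⇒≱ (m^n>0 q e) (≤-trans q^e≤ (≤-reflexive (*-zeroʳ (p ^ e)))) }

  [m*n]^o≡m^o*n^o : ∀ m n o → (m * n) ^ o ≡ m ^ o * n ^ o
  [m*n]^o≡m^o*n^o m n zero    = refl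
  [m*n]^o≡m^o*n^o m n (suc o) = trans (cong (m * n *_) ([m*n]^o≡m^o*n^o m n o)) (interchange m n (m ^ o) (n ^ o))
    where
    interchange : ∀ a b c d → a * b * (c * d) ≡ a * c * (b * d)
    interchange = solve-∀

  2^c*q^b≤p^b*N : ∀ {p q} N b c .{{_ : NonZero p}} → 2 * p ≤ q → q ^ (c + b) ≤ p ^ (c + b) * N → 2 ^ c * q ^ b ≤ p ^ b * N
  2^c*q^b≤p^b*N {p} {q} N b c 2p≤q q^[c+b]≤ = *-cancelˡ-≤ (p ^ c) {{m^n≢0 p c}} (begin
    p ^ c * (2 ^ c * q ^ b)   ≡⟨ rearrange (p ^ c) (2 ^ c) (q ^ b) ⟩
    2 ^ c * p ^ c * q ^ b     ≡⟨ cong (_* q ^ b) ([m*n]^o≡m^o*n^o 2 p c) ⟨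
    (2 * p) ^ c * q ^ b       ≤⟨ *-monoˡ-≤ (q ^ b) (^-monoˡ-≤ c 2p≤q) ⟩
    q ^ c * q ^ b             ≡⟨ ^-distribˡ-+-* q c b ⟨
    q ^ (c + b)               ≤⟨ q^[c+b]≤ ⟩
    p ^ (c + b) * N           ≡⟨ cong (_* N) (^-distribˡ-+-* p c b) ⟩
    p ^ c * p ^ b * N         ≡⟨ *-assoc (p ^ c) (p ^ b) N ⟩
    p ^ c * (p ^ b * N)       ∎)
    where
    open ≤-Reasoning
    rearrange : ∀ x y z → x * (y * z) ≡ y * x * z
    rearrange = solve-∀

  2^[3k]*q^[2k]≤p^[2k]*m : ∀ {p q} m k .{{_ : NonZero p}} → 2 * p ≤ q →
                           q ^ (5 * k) ≤ p ^ (5 * k) * m → 2 ^ (3 * k) * q ^ (k + k) ≤ p ^ (k + k) * m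
  2^[3k]*q^[2k]≤p^[2k]*m {p} {q} m k 2p≤q q^5k≤ =
    2^c*q^b≤p^b*N m (k + k) (3 * k) 2p≤q (subst (λ e → q ^ e ≤ p ^ e * m) (5k≡3k+2k k) q^5k≤)
    where
    5k≡3k+2k : ∀ k → 5 * k ≡ 3 * k + (k + k)
    5k≡3k+2k = solve-∀

  2^D*q^[2k]≤p^[2k]*M^k : ∀ {p q} M j .{{_ : NonZero p}} → 2 * p ≤ q → q ^ (5 * suc j) ≤ p ^ (5 * suc j) * M →
                          2 ^ ((3 + 5 * j) * suc j) * q ^ (suc j + suc j) ≤ p ^ (suc j + suc j) * M ^ suc j
  2^D*q^[2k]≤p^[2k]*M^k {p} {q} M j 2p≤q q^5k≤ = 2^c*q^b≤p^b*N (M ^ k) (k + k) D 2p≤q (begin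
    q ^ (D + (k + k))           ≡⟨ cong (q ^_) (5kk≡D+2k j) ⟨
    q ^ (5 * k * k)             ≡⟨ ^-*-assoc q (5 * k) k ⟨
    (q ^ (5 * k)) ^ k           ≤⟨ ^-monoˡ-≤ k q^5k≤ ⟩
    (p ^ (5 * k) * M) ^ k       ≡⟨ [m*n]^o≡m^o*n^o (p ^ (5 * k)) M k ⟩
    (p ^ (5 * k)) ^ k * M ^ k   ≡⟨ cong (_* M ^ k) (^-*-assoc p (5 * k) k) ⟩
    p ^ (5 * k * k) * M ^ k     ≡⟨ cong (λ e → p ^ e * M ^ k) (5kk≡D+2k j) ⟩
    p ^ (D + (k + k)) * M ^ k   ∎)
    where
    open ≤-Reasoning
    k = suc j
    D = (3 + 5 * j) * k
    5kk≡D+2k : ∀ j → 5 * suc j * suc j ≡ (3 + 5 * j) * suc j + (suc j + suc j)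
    5kk≡D+2k = solve-∀

  -- Each error term is at most half of p^t m M^t: every factor q/p ≥ 2 beyond the t needed absorbs a 2.
  drc-condition : ∀ {p q} m M j .{{_ : NonZero p}} → 2 * p ≤ q → m ≤ M →
    q ^ (5 * suc j) ≤ p ^ (5 * suc j) * m → q ^ (5 * suc j) ≤ p ^ (5 * suc j) * M →
    q ^ (suc j + suc j) * (pred (2 ^ j) * M ^ (suc j + suc j) + m * (m ^ suc j * (2 ^ j) ^ (suc j + suc j)))
      < p ^ (suc j + suc j) * m * M ^ (suc j + suc j)
  drc-condition {p} {q} m M j 2p≤q m≤M q^5k≤m q^5k≤M = begin-strict
    q ^ t * (pred K * M ^ t + m * (m ^ k * K ^ t))  <⟨ *-monoʳ-< (q ^ t) {{m^n≢0 q t}} (+-monoˡ-< _ (*-monoˡ-< (M ^ t) {{m^n≢0 M t}} pred[K]<K)) ⟩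
    q ^ t * (K * M ^ t + m * (m ^ k * K ^ t))       ≡⟨ expand (q ^ t) K (M ^ t) m (m ^ k) (K ^ t) ⟩
    X + Y                                           ≤⟨ m+m≤n+n⇒m≤n (subst (_≤ P + P) (interchange X Y) (+-mono-≤ X+X≤P Y+Y≤P)) ⟩
    P                                               ∎
    where
    open ≤-Reasoning
    k = suc j
    t = k + k
    K = 2 ^ j
    D = (3 + 5 * j) * k
    P = p ^ t * m * M ^ t
    X = K * q ^ t * M ^ t
    Y = q ^ t * K ^ t * (m * m ^ k)
    instance
      q≢0 : NonZero q
      q≢0 = 2p≤q⇒q≢0 2p≤q
      M≢0 : NonZero M
      M≢0 = q^e≤p^e*N⇒N≢0 {p} {q} (5 * k) q^5k≤M
    pred[K]<K : pred K < K
    pred[K]<K = ≤-reflexive (suc-pred K {{m^n≢0 2 j}})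
    expand : ∀ a b c d e f → a * (b * c + d * (e * f)) ≡ b * a * c + a * f * (d * e)
    expand = solve-∀
    interchange : ∀ x y → x + x + (y + y) ≡ (x + y) + (x + y)
    interchange = solve-∀
    X+X≤P : X + X ≤ P
    X+X≤P = begin
      X + X                        ≡⟨ double K (q ^ t) (M ^ t) ⟩
      2 * K * q ^ t * M ^ t        ≤⟨ *-monoˡ-≤ (M ^ t) (*-monoˡ-≤ (q ^ t) (^-monoʳ-≤ 2 (m≤m+n k _))) ⟩
      2 ^ (3 * k) * q ^ t * M ^ t  ≤⟨ *-monoˡ-≤ (M ^ t) (2^[3k]*q^[2k]≤p^[2k]*m m k 2p≤q q^5k≤m) ⟩
      P                            ∎
      where
      double : ∀ a b c → a * b * c + a * b * c ≡ 2 * a * b * c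
      double = solve-∀
    Y+Y≤P : Y + Y ≤ P
    Y+Y≤P = begin
      Y + Y                            ≡⟨ double (q ^ t) (K ^ t) (m * m ^ k) ⟩
      2 * K ^ t * q ^ t * (m * m ^ k)  ≤⟨ *-monoˡ-≤ (m * m ^ k) (*-monoˡ-≤ (q ^ t) 2*K^t≤2^D) ⟩
      2 ^ D * q ^ t * (m * m ^ k)      ≤⟨ *-monoˡ-≤ (m * m ^ k) (2^D*q^[2k]≤p^[2k]*M^k M j 2p≤q q^5k≤M) ⟩
      p ^ t * M ^ k * (m * m ^ k)      ≤⟨ *-monoʳ-≤ (p ^ t * M ^ k) (*-monoʳ-≤ m (^-monoˡ-≤ k m≤M)) ⟩
      p ^ t * M ^ k * (m * M ^ k)      ≡⟨ regroup (p ^ t) (M ^ k) m ⟩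
      p ^ t * m * (M ^ k * M ^ k)      ≡⟨ cong (p ^ t * m *_) (^-distribˡ-+-* M k k) ⟨
      P                                ∎
      where
      double : ∀ a b c → a * b * c + a * b * c ≡ 2 * b * a * c
      double = solve-∀
      regroup : ∀ a b c → a * b * (c * b) ≡ a * c * (b * b)
      regroup = solve-∀
      2*K^t≤2^D : 2 * K ^ t ≤ 2 ^ D
      2*K^t≤2^D = begin
        2 * K ^ t      ≡⟨ cong (2 *_) (^-*-assoc 2 j t) ⟩
        2 ^ suc (j * t) ≤⟨ ^-monoʳ-≤ 2 (subst (suc (j * t) ≤_) (sym (D≡ j)) (m≤m+n _ _)) ⟩
        2 ^ D          ∎
        where
        D≡ : ∀ j → (3 + 5 * j) * suc j ≡ suc (j * (suc j + suc j)) + (3 * j * j + 6 * j + 2)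
        D≡ = solve-∀

  density-transfer : ∀ {p q N M W m W'} .{{_ : NonZero N}} →
    p * N * M ≤ q * W → W * m ≤ W' * N → p * m * M ≤ q * W'
  density-transfer {p} {q} {N} {M} {W} {m} {W'} pNM≤qW Wm≤W'N = *-cancelˡ-≤ N (begin
    N * (p * m * M)  ≡⟨ rearrange₁ N p m M ⟩
    p * N * M * m    ≤⟨ *-monoˡ-≤ m pNM≤qW ⟩
    q * W * m        ≡⟨ *-assoc q W m ⟩
    q * (W * m)      ≤⟨ *-monoʳ-≤ q Wm≤W'N ⟩
    q * (W' * N)     ≡⟨ rearrange₂ q W' N ⟩
    N * (q * W')     ∎)
    where
    open ≤-Reasoning
    rearrange₁ : ∀ n p m M → n * (p * m * M) ≡ p * n * M * m
    rearrange₁ = solve-∀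
    rearrange₂ : ∀ q w n → q * (w * n) ≡ n * (q * w)
    rearrange₂ = solve-∀

  module _ {n : ℕ} (d : Fin n → ℕ) where

    density⇒power-sum : ∀ {p q M} (A : Subset n) s .{{_ : NonZero ∣ A ∣}} → p * ∣ A ∣ * M ≤ q * weight d A →
      p ^ suc s * ∣ A ∣ * M ^ suc s ≤ q ^ suc s * ∑[ a < n ] (χ A a * d a ^ suc s)
    density⇒power-sum {p} {q} {M} A s pmM≤qW = *-cancelˡ-≤ (m ^ s) {{m^n≢0 m s}} (begin
      m ^ s * (p ^ t * m * M ^ t)   ≡⟨ regroup (m ^ s) (p ^ t) m (M ^ t) ⟩
      p ^ t * (m * m ^ s) * M ^ t   ≡⟨ trans ([m*n]^o≡m^o*n^o (p * m) M t) (cong (_* M ^ t) ([m*n]^o≡m^o*n^o p m t)) ⟨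
      (p * m * M) ^ t               ≤⟨ ^-monoˡ-≤ t pmM≤qW ⟩
      (q * weight d A) ^ t          ≡⟨ [m*n]^o≡m^o*n^o q (weight d A) t ⟩
      q ^ t * weight d A ^ t        ≤⟨ *-monoʳ-≤ (q ^ t) W^t≤m^s*S ⟩
      q ^ t * (m ^ s * S)           ≡⟨ x*[y*z]≡y*[x*z] (q ^ t) (m ^ s) S ⟩
      m ^ s * (q ^ t * S)           ∎)
      where
      open ≤-Reasoning
      m = ∣ A ∣
      t = suc s
      S = ∑[ a < n ] (χ A a * d a ^ t)
      W^t≤m^s*S : weight d A ^ t ≤ m ^ s * S
      W^t≤m^s*S = subst (λ z → weight d A ^ t ≤ z ^ s * S) (sym (∣S∣≡∑χ A)) (power-mean (χ A) d s)
      regroup : ∀ a b c d → a * (b * c * d) ≡ b * (c * a) * d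
      regroup = solve-∀
      x*[y*z]≡y*[x*z] : ∀ x y z → x * (y * z) ≡ y * (x * z)
      x*[y*z]≡y*[x*z] = solve-∀

  module _ {n : ℕ} (T : Tournament n) where

    -- Shrinking A to m = min(|A|,|B|) vertices keeps the error term |A'|^(k+1) K^t of dependent random
    -- choice small compared with |A'| |B|^t.
    transitivePair-of-density : ∀ j (A B : Subset n) {p q} .{{_ : NonZero p}} → 2 * p ≤ q →
      p * ∣ A ∣ * ∣ B ∣ ≤ q * e T A B →
      q ^ (5 * suc j) ≤ p ^ (5 * suc j) * ∣ A ∣ → q ^ (5 * suc j) ≤ p ^ (5 * suc j) * ∣ B ∣ →
      TransitivePair T (suc j) A B
    transitivePair-of-density j A B {p} {q} 2p≤q dense bigA bigB =
      restrictTo (average-preserving-subset d m (∣ A ∣ ∸ m) A (>-nonZero⁻¹ m) (sym (m+[n∸m]≡n (m⊓n≤m ∣ A ∣ ∣ B ∣))))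
      where
      k = suc j
      t = k + k
      M = ∣ B ∣
      d : Fin n → ℕ
      d a = ∣ outNeighbours (adj T) B a ∣
      m = ∣ A ∣ ⊓ M
      bigm : q ^ (5 * k) ≤ p ^ (5 * k) * m
      bigm with ⊓-sel ∣ A ∣ M
      ... | inj₁ m≡∣A∣ = subst (λ z → q ^ (5 * k) ≤ p ^ (5 * k) * z) (sym m≡∣A∣) bigA
      ... | inj₂ m≡M   = subst (λ z → q ^ (5 * k) ≤ p ^ (5 * k) * z) (sym m≡M) bigB
      instance
        q≢0 : NonZero q
        q≢0 = 2p≤q⇒q≢0 2p≤q
        m≢0 : NonZero m
        m≢0 = q^e≤p^e*N⇒N≢0 {p} {q} (5 * k) bigm
        ∣A∣≢0 : NonZero ∣ A ∣
        ∣A∣≢0 = q^e≤p^e*N⇒N≢0 {p} {q} (5 * k) bigA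
      restrictTo : (∃ λ A' → A' ⊆ A × ∣ A' ∣ ≡ m × weight d A * m ≤ weight d A' * ∣ A ∣) → TransitivePair T k A B
      restrictTo (A' , A'⊆A , ∣A'∣≡m , average≤) =
        let (X , Y , X⊆A' , rest) = transitivePair T j t A' B drcHypothesis
        in X , Y , A'⊆A ∘ X⊆A' , rest
        where
        open ≤-Reasoning
        denseA' : p * ∣ A' ∣ * M ≤ q * weight d A'
        denseA' = subst (λ z → p * z * M ≤ q * weight d A') (sym ∣A'∣≡m)
                        (density-transfer {p} {q} (subst (λ z → p * ∣ A ∣ * M ≤ q * z) (e≡∑∣outNeighbours∣ T A B) dense) average≤)
        drcHypothesis : pred (2 ^ j) * M ^ t + ∣ A' ∣ * (∣ A' ∣ ^ k * (2 ^ j) ^ t) < ∑[ a < n ] (χ A' a * d a ^ t)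
        drcHypothesis = *-cancelˡ-< (q ^ t) _ _ (begin-strict
          q ^ t * (pred (2 ^ j) * M ^ t + ∣ A' ∣ * (∣ A' ∣ ^ k * (2 ^ j) ^ t))
            <⟨ subst (λ z → q ^ t * (pred (2 ^ j) * M ^ t + z * (z ^ k * (2 ^ j) ^ t)) < p ^ t * z * M ^ t)
                     (sym ∣A'∣≡m) (drc-condition m M j 2p≤q (m⊓n≤n ∣ A ∣ M) bigm bigB) ⟩
          p ^ t * ∣ A' ∣ * M ^ t
            ≤⟨ density⇒power-sum d {p} {q} A' (j + k) {{subst NonZero (sym ∣A'∣≡m) m≢0}} denseA' ⟩
          q ^ t * ∑[ a < n ] (χ A' a * d a ^ t) ∎)

  -- Reading the rational hypotheses in ℕ

  ≤ᵘ⇒ℕ≤ : ∀ {u v : ℚᵘ} {a b c d} → ↥ᵘ u ≡ ℤ.+ a → ↧ᵘ u ≡ ℤ.+ b → ↥ᵘ v ≡ ℤ.+ c → ↧ᵘ v ≡ ℤ.+ d → u ℚᵘ.≤ v → a * d ≤ c * b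
  ≤ᵘ⇒ℕ≤ {a = a} {b} {c} {d} ↥u ↧u ↥v ↧v (ℚᵘ.*≤* u≤v) = ℤ.drop‿+≤+ (subst₂ ℤ._≤_
    (trans (cong₂ ℤ._*_ ↥u ↧v) (sym (ℤ.pos-* a d))) (trans (cong₂ ℤ._*_ ↥v ↧u) (sym (ℤ.pos-* c b))) u≤v)

  toℚᵘ-ℕtoℚ : ∀ N → toℚᵘ (ℕtoℚ N) ℚᵘ.≃ mkℚᵘ (ℤ.+ N) 0
  toℚᵘ-ℕtoℚ N = toℚᵘ-fromℚᵘ (mkℚᵘ (ℤ.+ N) 0)

  _^ᵘ_ : ℚᵘ → ℕ → ℚᵘ
  x ^ᵘ zero  = ℚᵘ.1ℚᵘ
  x ^ᵘ suc m = x ℚᵘ.* (x ^ᵘ m)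

  toℚᵘ-homo-^ : ∀ x m → toℚᵘ (x ^ℚ m) ℚᵘ.≃ toℚᵘ x ^ᵘ m
  toℚᵘ-homo-^ x zero    = ℚᵘ.≃-refl
  toℚᵘ-homo-^ x (suc m) = ℚᵘ.≃-trans (toℚᵘ-homo-* x (x ^ℚ m)) (ℚᵘ.*-congˡ {toℚᵘ x} (toℚᵘ-homo-^ x m))

  ↥ᵘ-* : ∀ x y → ↥ᵘ (x ℚᵘ.* y) ≡ ↥ᵘ x ℤ.* ↥ᵘ y
  ↥ᵘ-* (mkℚᵘ _ _) (mkℚᵘ _ _) = refl

  ↧ᵘ-* : ∀ x y → ↧ᵘ (x ℚᵘ.* y) ≡ ↧ᵘ x ℤ.* ↧ᵘ y
  ↧ᵘ-* (mkℚᵘ _ _) (mkℚᵘ _ _) = refl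

  ↥-^ᵘ : ∀ a b m → ↥ᵘ (mkℚᵘ (ℤ.+ a) b ^ᵘ m) ≡ ℤ.+ (a ^ m)
  ↥-^ᵘ a b zero    = refl
  ↥-^ᵘ a b (suc m) = trans (↥ᵘ-* (mkℚᵘ (ℤ.+ a) b) (mkℚᵘ (ℤ.+ a) b ^ᵘ m)) (trans (cong (ℤ.+ a ℤ.*_) (↥-^ᵘ a b m)) (sym (ℤ.pos-* a (a ^ m))))

  ↧-^ᵘ : ∀ a b m → ↧ᵘ (mkℚᵘ (ℤ.+ a) b ^ᵘ m) ≡ ℤ.+ (suc b ^ m)
  ↧-^ᵘ a b zero    = refl
  ↧-^ᵘ a b (suc m) = trans (↧ᵘ-* (mkℚᵘ (ℤ.+ a) b) (mkℚᵘ (ℤ.+ a) b ^ᵘ m)) (trans (cong (ℤ.+ suc b ℤ.*_) (↧-^ᵘ a b m)) (sym (ℤ.pos-* (suc b) (suc b ^ m))))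

  module _ (p₀ d : ℕ) .(coprime : Coprime (suc p₀) (suc d)) where

    β≤½⇒2p≤q : mkℚ ℤ.+[1+ p₀ ] d coprime ℚ.≤ ½ → 2 * suc p₀ ≤ suc d
    β≤½⇒2p≤q β≤½ = subst₂ _≤_ (*-comm (suc p₀) 2) (*-identityˡ (suc d)) (≤ᵘ⇒ℕ≤ refl refl refl refl (toℚᵘ-mono-≤ β≤½))

    β-density⇒ℕ : ∀ N M E → mkℚ ℤ.+[1+ p₀ ] d coprime ℚ.* ℕtoℚ N ℚ.* ℕtoℚ M ℚ.≤ ℕtoℚ E → suc p₀ * N * M ≤ suc d * E
    β-density⇒ℕ N M E βNM≤E =
      subst₂ _≤_ (*-identityʳ _) (trans (cong (E *_) (trans (*-identityʳ _) (*-identityʳ _))) (*-comm E (suc d)))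
        (≤ᵘ⇒ℕ≤ {u = βNMᵘ} {v = mkℚᵘ (ℤ.+ E) 0}
               (trans (cong (ℤ._* ℤ.+ M) (sym (ℤ.pos-* (suc p₀) N))) (sym (ℤ.pos-* (suc p₀ * N) M))) refl refl refl
               (ℚᵘ.≤-respʳ-≃ (toℚᵘ-ℕtoℚ E) (ℚᵘ.≤-respˡ-≃ toℚᵘ-βNM (toℚᵘ-mono-≤ βNM≤E))))
      where
      β = mkℚ ℤ.+[1+ p₀ ] d coprime
      βNMᵘ : ℚᵘ
      βNMᵘ = mkℚᵘ ℤ.+[1+ p₀ ] d ℚᵘ.* mkℚᵘ (ℤ.+ N) 0 ℚᵘ.* mkℚᵘ (ℤ.+ M) 0
      toℚᵘ-βNM : toℚᵘ (β ℚ.* ℕtoℚ N ℚ.* ℕtoℚ M) ℚᵘ.≃ βNMᵘ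
      toℚᵘ-βNM = ℚᵘ.≃-trans (toℚᵘ-homo-* (β ℚ.* ℕtoℚ N) (ℕtoℚ M))
                   (ℚᵘ.*-cong (ℚᵘ.≃-trans (toℚᵘ-homo-* β (ℕtoℚ N)) (ℚᵘ.*-congˡ {mkℚᵘ ℤ.+[1+ p₀ ] d} (toℚᵘ-ℕtoℚ N)))
                              (toℚᵘ-ℕtoℚ M))

    [1/β]^m≤N⇒ℕ : ∀ m N →
      (1/ mkℚ ℤ.+[1+ p₀ ] d coprime) ^ℚ m ℚ.≤ ℕtoℚ N → suc d ^ m ≤ suc p₀ ^ m * N
    [1/β]^m≤N⇒ℕ m N [1/β]^m≤N = subst₂ _≤_ (*-identityʳ _) (*-comm N _)
      (≤ᵘ⇒ℕ≤ {u = mkℚᵘ (ℤ.+ suc d) p₀ ^ᵘ m} {v = mkℚᵘ (ℤ.+ N) 0} (↥-^ᵘ (suc d) p₀ m) (↧-^ᵘ (suc d) p₀ m) refl refl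
             (ℚᵘ.≤-respʳ-≃ (toℚᵘ-ℕtoℚ N) (ℚᵘ.≤-respˡ-≃ (toℚᵘ-homo-^ (mkℚ ℤ.+[1+ d ] p₀ _) m) (toℚᵘ-mono-≤ [1/β]^m≤N))))

open import Defs
open import Data.Nat using (ℕ; NonZero) renaming (_*_ to _*ₙ_)
open import Data.Fin.Subset using (Subset; _⊆_; ∣_∣)
open import Data.Product using (∃₂; _×_)
open import Data.Rational using (ℚ; Positive; _≤_; _*_; ½; 1/_)
open import Data.Rational.Properties using (pos⇒nonZero)
open import Relation.Binary.PropositionalEquality using (_≡_)

open import Data.Nat using (suc)
open import Data.Integer using (+[1+_])
open import Data.Product using (_,_)
open import Data.Rational using (mkℚ)

corollary2p5 : (k : ℕ) → .{{_ : NonZero k}} → (n : ℕ) → (T : Tournament n)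
    → (A B : Subset n) → Disjoint A B
    → (β : ℚ) → .{{pβ : Positive β}} → β ≤ ½
    → β * (ℕtoℚ ∣ A ∣) * (ℕtoℚ ∣ B ∣) ≤ ℕtoℚ (e T A B)
    → (1/_ β {{pos⇒nonZero β}}) ^ℚ (5 *ₙ k) ≤ ℕtoℚ ∣ A ∣
    → (1/_ β {{pos⇒nonZero β}}) ^ℚ (5 *ₙ k) ≤ ℕtoℚ ∣ B ∣
    → ∃₂ λ (X Y : Subset n) →
        X ⊆ A × Y ⊆ B × ∣ X ∣ ≡ k × ∣ Y ∣ ≡ k
        × Transitive T X × Transitive T Y × _⇒_ T X Y
corollary2p5 (suc j) n T A B A∩B≡∅ (mkℚ +[1+ p₀ ] d coprime) β≤½ dense bigA bigB =
  withDisjointness (transitivePair-of-density T j A B {suc p₀} {suc d} (β≤½⇒2p≤q p₀ d coprime β≤½)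
         (β-density⇒ℕ p₀ d coprime ∣ A ∣ ∣ B ∣ (e T A B) dense)
         ([1/β]^m≤N⇒ℕ p₀ d coprime (5 *ₙ suc j) ∣ A ∣ bigA) ([1/β]^m≤N⇒ℕ p₀ d coprime (5 *ₙ suc j) ∣ B ∣ bigB))
  where
  withDisjointness : TransitivePair T (suc j) A B → ∃₂ λ (X Y : Subset n) →
        X ⊆ A × Y ⊆ B × ∣ X ∣ ≡ suc j × ∣ Y ∣ ≡ suc j × Transitive T X × Transitive T Y × _⇒_ T X Y
  withDisjointness (X , Y , X⊆A , Y⊆B , ∣X∣≡k , ∣Y∣≡k , transitiveX , transitiveY , X⟶Y) =
    X , Y , X⊆A , Y⊆B , ∣X∣≡k , ∣Y∣≡k , transitiveX , transitiveY , (λ v v∈X v∈Y → A∩B≡∅ v (X⊆A v∈X) (Y⊆B v∈Y)) , X⟶Y
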